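{- Let $m,q\ge2$ be integers and let $\bm H_{m,q}$ and $\widetilde{\bm F}_{m,q}$ be as in the context. Then $$\bm H_{m,q}=T\!\left(\frac{m-1+(q-m)x}{m+(q-1-m)x}\cdot\frac{q}{q-1}\cdot\frac{q-x}{q-1}\,\Big|\,\frac{q-x}{q-1}\right)\widetilde{\bm F}_{m,q},\qquad \bm H_{m,q}=\widetilde{\bm F}_{m,q}\,T\!\left(\frac{q(m-1)+(q-1)x}{(q-1)(m+x)}\cdot\frac{q}{q-1}\,\Big|\,\frac{q}{q-1}\right).$$ In particular, when $m=q$ the two factors are $T\left(\frac{q}{q-1}\mid\frac{q-x}{q-1}\right)$ and $T\left(\frac{q}{q-1}\mid\frac{q}{q-1}\right)$ respectively. Moreover, $\widetilde{\bm F}_{1,1}=T(1\mid 1-x)$ is Pascal's triangle and $$\widetilde{\bm F}_{q,q}=T\!\left(\frac1q\,\Big|\,\frac{1+(q-1)x}{q}\right)\widetilde{\bm F}_{1,1},\qquad \widetilde{\bm F}_{q,q}=\widetilde{\bm F}_{1,1}\,T\!\left(\frac1q\,\Big|\,\frac1q\right).$$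
   Context: For $\alpha,\omega\in\mathbb C[[x]]$ with $\alpha(0),\omega(0)\ne0$, $T(\alpha\mid\omega)$ is the infinite lower triangular matrix $(d_{ij})_{i,j\ge0}$ with $d_{ij}=[x^i]\,x^j\alpha(x)/\omega(x)^{j+1}$. $[k]$ is the $0$-dimensional complex with $k$ vertices, $\mathcal F*\mathcal K=\{\sigma\cup\tau:\sigma\in\mathcal F\cup\{\emptyset\},\tau\in\mathcal K\cup\{\emptyset\}\}$ the join, $\Delta^{(0)}_{m,q}=[m]$, $\Delta^{(n)}_{m,q}=\Delta^{(n-1)}_{m,q}*[q]$. $\widetilde{\bm F}_{m,q}=(d_{n,k})$ has $d_{0,0}=m/q$, $d_{0,k}=0$ ($k\ge1$), and for $n\ge1$ its $n$-th row is the extended $f$-vector $(1,f_0,\ldots,f_{n-1})$ of $\Delta^{(n-1)}_{m,q}$ followed by zeros. $\bm H_{m,q}=(h_{ij})$ has $h_{00}=(m-1)/(q-1)$, $h_{0j}=0$ ($j\ge1$), and for $i\ge1$ its $i$-th row is the coefficient vector of the $h$-polynomial of $\Delta^{(i-1)}_{m,q}$ followed by zeros, where for a $d$-dimensional complex $h_k=\sum_{i=0}^k(-1)^{k-i}\binom{d+1-i}{d+1-k}f_{i-1}$, $f_{ -1}=1$. -}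

module Defs where

open import Data.Nat as ℕ using (ℕ; zero; suc; _≤?_)
open import Data.Nat.Combinatorics using (_C_)
open import Data.Integer using (+_)
open import Data.Rational using (ℚ; 0ℚ; 1ℚ; _+_; _*_; _-_; -_; 1/_; ≢-nonZero; _/_)
open import Data.Rational.Properties using (_≟_)
open import Data.Fin using (Fin; toℕ)
open import Data.Vec as Vec using (Vec; []; _∷_)
open import Data.List as List using (List; []; _∷_; _++_; map; concatMap; filter; length; allFin; foldr)
open import Data.Sum using (_⊎_; inj₁; inj₂)
open import Relation.Nullary using (yes; no)
open import Relation.Binary.PropositionalEquality using (_≡_)

ℕ→ℚ : ℕ → ℚ
ℕ→ℚ n = + n / 1

-- total reciprocal (1/0 := 0; never used at 0 under the hypotheses)
inv0 : ℚ → ℚ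
inv0 p with p ≟ 0ℚ
... | yes _ = 0ℚ
... | no ne = 1/_ p {{≢-nonZero ne}}

_÷₀_ : ℚ → ℚ → ℚ
p ÷₀ r = p * inv0 r

Σ< : ℕ → (ℕ → ℚ) → ℚ
Σ< zero    f = 0ℚ
Σ< (suc n) f = Σ< n f + f n

sgn : ℕ → ℚ
sgn zero    = 1ℚ
sgn (suc n) = - sgn n

-- Formal power series over ℚ : coefficient sequences

PS : Set
PS = ℕ → ℚ

-- polynomial given by its coefficient list (constant term first)
poly : List ℚ → PS
poly []       n       = 0ℚ
poly (a ∷ as) zero    = a
poly (a ∷ as) (suc n) = poly as n

const : ℚ → PS
const a = poly (a ∷ [])

_·ₛ_ : PS → PS → PS
(f ·ₛ g) n = Σ< (suc n) (λ k → f k * g (n ℕ.∸ k))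

powₛ : PS → ℕ → PS
powₛ f zero    = const 1ℚ
powₛ f (suc n) = powₛ f n ·ₛ f

-- coefficients b_n, b_{n-1}, …, b_0 of the multiplicative inverse of f
-- (b_0 = 1/a_0,  b_n = -(1/a_0) Σ_{k=1}^{n} a_k b_{n-k})
invVec : PS → (n : ℕ) → Vec ℚ (suc n)
invVec f zero    = inv0 (f 0) ∷ []
invVec f (suc n) =
  (- (inv0 (f 0) * Vec.foldr _ _+_ 0ℚ
        (Vec.zipWith _*_ (Vec.tabulate (λ (i : Fin (suc n)) → f (suc (toℕ i)))) bs)))
  ∷ bs
  where bs = invVec f n

-- 1/f  (meaningful when f(0) ≠ 0)
invₛ : PS → PS
invₛ f n = Vec.head (invVec f n)

shiftₛ : ℕ → PS → PS
shiftₛ j g i with j ≤? i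
... | yes _ = g (i ℕ.∸ j)
... | no  _ = 0ℚ

Mat : Set
Mat = ℕ → ℕ → ℚ

-- product of lower triangular matrices: (AB)_{ij} = Σ_{k=0}^{i} A_{ik} B_{kj}
_⊙_ : Mat → Mat → Mat
(A ⊙ B) i j = Σ< (suc i) (λ k → A i k * B k j)

T : PS → PS → Mat
T α ω i j = shiftₛ j (α ·ₛ invₛ (powₛ ω (suc j))) i

-- Finite simplicial complexes, given by a vertex type and the list of
-- all faces (each face a list of distinct vertices; the empty face is
-- included in the list).

record Complex : Set₁ where
  field
    V     : Set
    faces : List (List V)
open Complex public

pts : ℕ → Complex
pts k = record { V = Fin k ; faces = [] ∷ map (λ v → v ∷ []) (allFin k) }

-- join F * K = {σ ∪ τ : σ ∈ F ∪ {∅}, τ ∈ K ∪ {∅}} on disjoint vertex sets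
-- (∅ already belongs to both face lists)
_⋆_ : Complex → Complex → Complex
F ⋆ K = record
  { V     = V F ⊎ V K
  ; faces = concatMap (λ σ → map (λ τ → map inj₁ σ ++ map inj₂ τ) (faces K)) (faces F) }

Δ : ℕ → ℕ → ℕ → Complex
Δ m q zero    = pts m
Δ m q (suc n) = Δ m q n ⋆ pts q

-- fnum K k = f_{k-1}(K) : number of faces with k vertices (f_{-1} = 1)
fnum : Complex → ℕ → ℕ
fnum K k = length (filter (λ σ → length σ ℕ.≟ k) (faces K))

-- dim K + 1 = maximal number of vertices of a face
rank : Complex → ℕ
rank K = foldr ℕ._⊔_ 0 (map length (faces K))

hnum : Complex → ℕ → ℚ
hnum K k = Σ< (suc k) (λ i →
  sgn (k ℕ.∸ i) * ℕ→ℚ ((rank K ℕ.∸ i) C (rank K ℕ.∸ k)) * ℕ→ℚ (fnum K i))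

Ftilde : ℕ → ℕ → Mat
Ftilde m q zero    zero    = ℕ→ℚ m ÷₀ ℕ→ℚ q
Ftilde m q zero    (suc k) = 0ℚ
Ftilde m q (suc n) k       = ℕ→ℚ (fnum (Δ m q n) k)

-- row i ≥ 1: coefficients h_0, …, h_{d+1} of the h-polynomial of
-- Δ^{(i-1)} (d = its dimension), followed by zeros
Hmat : ℕ → ℕ → Mat
Hmat m q zero    zero    = (ℕ→ℚ m - 1ℚ) ÷₀ (ℕ→ℚ q - 1ℚ)
Hmat m q zero    (suc k) = 0ℚ
Hmat m q (suc i) k with k ≤? rank (Δ m q i)
... | yes _ = hnum (Δ m q i) k
... | no  _ = 0ℚ

_≋_ : Mat → Mat → Set
A ≋ B = ∀ i j → A i j ≡ B i j

-- Every matrix involved satisfies a recurrence L i j = a L (i+1) (j+1) + b L i (j+1), the one of a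
-- Riordan array T(α | a + b x): F̃_{m,q} with a = -b = 1/q and H_{m,q} with a = -b = 1/(q-1), since
-- joining with [q] multiplies the f-polynomial by 1 + q x and the h-polynomial by 1 + (q-1) x (the
-- corner entries m/q and (m-1)/(q-1) are exactly what makes row 0 fit). A product of two such
-- matrices satisfies the recurrence of T(α | c ω + d x), and a matrix satisfying such a recurrence
-- with a ≠ 0 is determined by its first column. So each factorization reduces to matching the
-- coefficients of the recurrences and the first columns; the first column of A ⊙ B is A applied to
-- the first column v of B, and when v = (n₀ + n₁ x) / (d₀ + d₁ x) this is a power-series identity
-- checked coefficientwise.

{-# OPTIONS --safe #-}
module Submission where

open import Defs
open import Data.Nat using (ℕ; _≤_)
open import Data.Nat.Combinatorics using (_C_)
open import Data.Rational using (ℚ; 1ℚ; _+_; _*_; _-_; -_)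
open import Data.List using (List; []; _∷_)
open import Data.Product using (_×_)
open import Relation.Binary.PropositionalEquality using (_≡_)

open import Data.Bool using (if_then_else_; true; false)
open import Data.Fin as Fin using (Fin; toℕ)
import Data.Integer as ℤ
import Data.Integer.Tactic.RingSolver as ℤ-Solver
open import Data.List as List using (_++_; map; concatMap; filter; length; allFin; foldr)
import Data.List.Properties as List
open import Data.Nat as ℕ using (zero; suc; _∸_; _<_; _⊔_; _≡ᵇ_; z≤n; s≤s; s≤s⁻¹; _≤?_)
open import Data.Nat.Combinatorics using (nCk+nC[k+1]≡[n+1]C[k+1]; k>n⇒nCk≡0; nCk≡nC[n∸k])
import Data.Nat.Properties as ℕₚ
import Data.Nat.Tactic.RingSolver as ℕ-Solver
open import Data.Product using (∃; _,_)
open import Data.Rational using (0ℚ; toℚᵘ; ≢-nonZero)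
open import Data.Rational.Properties
  using (_≟_; +-*-commutativeRing; *-inverseʳ; 1≢0; toℚᵘ-injective; toℚᵘ-fromℚᵘ; toℚᵘ-homo-+;
         +-identityˡ; +-identityʳ; +-assoc; +-comm; *-identityˡ; *-identityʳ; *-zeroˡ; *-zeroʳ; *-assoc; *-comm)
import Data.Rational.Unnormalised as ℚᵘ
import Data.Rational.Unnormalised.Properties as ℚᵘₚ
open import Data.Sum using (_⊎_; inj₁; inj₂)
open import Data.Vec as Vec using (Vec)
open import Function using (_∘_)
open import Level using (0ℓ)
open import Relation.Binary.PropositionalEquality
  using (refl; sym; trans; cong; cong₂; subst; subst₂; _≢_; _≗_; module ≡-Reasoning)
open import Relation.Nullary using (yes; no; contradiction; Dec)
open import Relation.Nullary.Decidable using (dec⇒maybe)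
open import Tactic.RingSolver using (solve-∀; solve)
open import Tactic.RingSolver.Core.AlmostCommutativeRing using (AlmostCommutativeRing; fromCommutativeRing)

ℚ-ring : AlmostCommutativeRing 0ℓ 0ℓ
ℚ-ring = fromCommutativeRing +-*-commutativeRing (λ x → dec⇒maybe (0ℚ ≟ x))

ℕ→ℚ-+ : ∀ a b → ℕ→ℚ (a ℕ.+ b) ≡ ℕ→ℚ a + ℕ→ℚ b
ℕ→ℚ-+ a b = toℚᵘ-injective (begin-equality
  toℚᵘ (ℕ→ℚ (a ℕ.+ b))                     ≃⟨ toℚᵘ-fromℚᵘ _ ⟩
  ℚᵘ.mkℚᵘ (ℤ.+ a ℤ.+ ℤ.+ b) 0                  ≃⟨ ℚᵘ.*≡* (ℤ-identity (ℤ.+ a) (ℤ.+ b)) ⟩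
  ℚᵘ.mkℚᵘ (ℤ.+ a) 0 ℚᵘ.+ ℚᵘ.mkℚᵘ (ℤ.+ b) 0      ≃⟨ ℚᵘₚ.+-cong (toℚᵘ-fromℚᵘ (ℚᵘ.mkℚᵘ (ℤ.+ a) 0)) (toℚᵘ-fromℚᵘ (ℚᵘ.mkℚᵘ (ℤ.+ b) 0)) ⟨
  toℚᵘ (ℕ→ℚ a) ℚᵘ.+ toℚᵘ (ℕ→ℚ b)            ≃⟨ toℚᵘ-homo-+ (ℕ→ℚ a) (ℕ→ℚ b) ⟨
  toℚᵘ (ℕ→ℚ a + ℕ→ℚ b)                     ∎)
  where
  open ℚᵘₚ.≤-Reasoning
  ℤ-identity : ∀ x y → (x ℤ.+ y) ℤ.* ℤ.1ℤ ≡ (x ℤ.* ℤ.1ℤ ℤ.+ y ℤ.* ℤ.1ℤ) ℤ.* ℤ.1ℤ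
  ℤ-identity = ℤ-Solver.solve-∀

ℕ→ℚ-* : ∀ a b → ℕ→ℚ (a ℕ.* b) ≡ ℕ→ℚ a * ℕ→ℚ b
ℕ→ℚ-* zero    b = sym (*-zeroˡ (ℕ→ℚ b))
ℕ→ℚ-* (suc a) b = begin
  ℕ→ℚ (b ℕ.+ a ℕ.* b)             ≡⟨ trans (ℕ→ℚ-+ b (a ℕ.* b)) (cong (ℕ→ℚ b +_) (ℕ→ℚ-* a b)) ⟩
  ℕ→ℚ b + ℕ→ℚ a * ℕ→ℚ b           ≡⟨ distrib (ℕ→ℚ a) (ℕ→ℚ b) ⟩
  (1ℚ + ℕ→ℚ a) * ℕ→ℚ b            ≡⟨ cong (_* ℕ→ℚ b) (ℕ→ℚ-+ 1 a) ⟨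
  ℕ→ℚ (suc a) * ℕ→ℚ b             ∎
  where
  open ≡-Reasoning
  distrib : ∀ x y → y + x * y ≡ (1ℚ + x) * y
  distrib = solve-∀ ℚ-ring

ℕ→ℚ-suc≢0 : ∀ n → ℕ→ℚ (suc n) ≢ 0ℚ
ℕ→ℚ-suc≢0 n eq with ℚᵘₚ.≃-trans (ℚᵘₚ.≃-sym (toℚᵘ-fromℚᵘ (ℚᵘ.mkℚᵘ (ℤ.+ suc n) 0))) (ℚᵘₚ.≃-reflexive (cong toℚᵘ eq))
... | ℚᵘ.*≡* ()

*-inv0 : ∀ p → p ≢ 0ℚ → p * inv0 p ≡ 1ℚ
*-inv0 p p≢0 with p ≟ 0ℚ
... | yes p≡0 = contradiction p≡0 p≢0
... | no  p≢0 = *-inverseʳ p {{≢-nonZero p≢0}}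

*-cancelˡ : ∀ {a x y} → a ≢ 0ℚ → a * x ≡ a * y → x ≡ y
*-cancelˡ {a} {x} {y} a≢0 eq = begin
  x                  ≡⟨ undo x ⟩
  inv0 a * (a * x)   ≡⟨ cong (inv0 a *_) eq ⟩
  inv0 a * (a * y)   ≡⟨ undo y ⟨
  y                  ∎
  where
  open ≡-Reasoning
  undo : ∀ z → z ≡ inv0 a * (a * z)
  undo z = begin
    z                  ≡⟨ *-identityˡ z ⟨
    1ℚ * z             ≡⟨ cong (_* z) (trans (*-comm (inv0 a) a) (*-inv0 a a≢0)) ⟨
    inv0 a * a * z     ≡⟨ *-assoc (inv0 a) a z ⟩
    inv0 a * (a * z)   ∎

+-cancelʳ : ∀ {x y} c → x + c ≡ y + c → x ≡ y
+-cancelʳ {x} {y} c eq = begin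
  x            ≡⟨ undo x c ⟩
  x + c - c    ≡⟨ cong (_- c) eq ⟩
  y + c - c    ≡⟨ undo y c ⟨
  y            ∎
  where
  open ≡-Reasoning
  undo : ∀ z c → z ≡ z + c - c
  undo = solve-∀ ℚ-ring

*-≢0 : ∀ {a b} → a ≢ 0ℚ → b ≢ 0ℚ → a * b ≢ 0ℚ
*-≢0 {a} {b} a≢0 b≢0 ab≡0 = b≢0 (*-cancelˡ a≢0 (trans ab≡0 (sym (*-zeroʳ a))))

≢0-factorˡ : ∀ {a b c} → a * b ≡ c → c ≢ 0ℚ → a ≢ 0ℚ
≢0-factorˡ {a} {b} ab≡c c≢0 a≡0 = c≢0 (trans (sym ab≡c) (trans (cong (_* b) a≡0) (*-zeroˡ b)))

≢0-factorʳ : ∀ {a b c} → a * b ≡ c → c ≢ 0ℚ → b ≢ 0ℚ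
≢0-factorʳ {a} {b} ab≡c = ≢0-factorˡ (trans (*-comm b a) ab≡c)

Σ-cong : ∀ n {f g : ℕ → ℚ} → (∀ {k} → k < n → f k ≡ g k) → Σ< n f ≡ Σ< n g
Σ-cong zero    eq = refl
Σ-cong (suc n) eq = cong₂ _+_ (Σ-cong n (eq ∘ ℕₚ.m<n⇒m<1+n)) (eq (ℕₚ.n<1+n n))

Σ-cong′ : ∀ n {f g : ℕ → ℚ} → f ≗ g → Σ< n f ≡ Σ< n g
Σ-cong′ n eq = Σ-cong n (λ {k} _ → eq k)

Σ-zero : ∀ n {f : ℕ → ℚ} → (∀ {k} → k < n → f k ≡ 0ℚ) → Σ< n f ≡ 0ℚ
Σ-zero zero    eq = refl
Σ-zero (suc n) eq = trans (cong₂ _+_ (Σ-zero n (eq ∘ ℕₚ.m<n⇒m<1+n)) (eq (ℕₚ.n<1+n n))) (+-identityʳ 0ℚ)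

Σ-+ : ∀ n (f g : ℕ → ℚ) → Σ< n (λ k → f k + g k) ≡ Σ< n f + Σ< n g
Σ-+ zero    f g = refl
Σ-+ (suc n) f g =
  trans (cong (_+ (f n + g n)) (Σ-+ n f g)) (interchange (Σ< n f) (Σ< n g) (f n) (g n))
  where
  interchange : ∀ a b c d → a + b + (c + d) ≡ a + c + (b + d)
  interchange = solve-∀ ℚ-ring

Σ-* : ∀ n c (f : ℕ → ℚ) → Σ< n (λ k → c * f k) ≡ c * Σ< n f
Σ-* zero    c f = sym (*-zeroʳ c)
Σ-* (suc n) c f = trans (cong (_+ c * f n) (Σ-* n c f)) (distrib c (Σ< n f) (f n))
  where
  distrib : ∀ c a b → c * a + c * b ≡ c * (a + b)
  distrib = solve-∀ ℚ-ring

Σ-head : ∀ n (f : ℕ → ℚ) → Σ< (suc n) f ≡ f 0 + Σ< n (f ∘ suc)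
Σ-head zero    f = swap (f 0)
  where
  swap : ∀ a → 0ℚ + a ≡ a + 0ℚ
  swap = solve-∀ ℚ-ring
Σ-head (suc n) f = trans (cong (_+ f (suc n)) (Σ-head n f)) (+-assoc (f 0) (Σ< n (f ∘ suc)) (f (suc n)))

Σ-reverse : ∀ n (f : ℕ → ℚ) → Σ< (suc n) f ≡ Σ< (suc n) (λ k → f (n ∸ k))
Σ-reverse zero    f = refl
Σ-reverse (suc n) f = begin
  Σ< (suc n) f + f (suc n)                       ≡⟨ cong (_+ f (suc n)) (Σ-reverse n f) ⟩
  Σ< (suc n) (λ k → f (n ∸ k)) + f (suc n)       ≡⟨ +-comm _ (f (suc n)) ⟩
  f (suc n) + Σ< (suc n) (λ k → f (n ∸ k))       ≡⟨ Σ-head (suc n) (λ k → f (suc n ∸ k)) ⟨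
  Σ< (suc (suc n)) (λ k → f (suc n ∸ k))         ∎
  where open ≡-Reasoning

lin : ℚ → ℚ → PS → PS
lin a b h zero    = a * h 0
lin a b h (suc n) = a * h (suc n) + b * h n

Linear : PS → ℚ → ℚ → Set
Linear ω a b = ω ≗ poly (a ∷ b ∷ [])

const-linear : ∀ a → Linear (const a) a 0ℚ
const-linear a zero          = refl
const-linear a (suc zero)    = refl
const-linear a (suc (suc n)) = refl

lin-cong : ∀ a b {g h} → g ≗ h → lin a b g ≗ lin a b h
lin-cong a b eq zero    = cong (a *_) (eq 0)
lin-cong a b eq (suc n) = cong₂ (λ x y → a * x + b * y) (eq (suc n)) (eq n)

lin-coeffs : ∀ {a a′ b b′} → a ≡ a′ → b ≡ b′ → ∀ h → lin a b h ≗ lin a′ b′ h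
lin-coeffs refl refl h n = refl

lin-const : ∀ c h → lin c 0ℚ h ≗ λ n → c * h n
lin-const c h zero    = refl
lin-const c h (suc n) = drop c (h (suc n)) (h n)
  where
  drop : ∀ c x y → c * x + 0ℚ * y ≡ c * x
  drop = solve-∀ ℚ-ring

lin-scale : ∀ c a b h → lin (c * a) (c * b) h ≗ λ n → c * lin a b h n
lin-scale c a b h zero    = *-assoc′ c a (h 0)
  where
  *-assoc′ : ∀ c a x → c * a * x ≡ c * (a * x)
  *-assoc′ = solve-∀ ℚ-ring
lin-scale c a b h (suc n) = distrib c a b (h (suc n)) (h n)
  where
  distrib : ∀ c a b x y → c * a * x + c * b * y ≡ c * (a * x + b * y)
  distrib = solve-∀ ℚ-ring

lin-cancel : ∀ {a b g h} → a ≢ 0ℚ → lin a b g ≗ lin a b h → g ≗ h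
lin-cancel a≢0 eq zero    = *-cancelˡ a≢0 (eq 0)
lin-cancel {a} {b} {g} {h} a≢0 eq (suc n) = *-cancelˡ a≢0 (+-cancelʳ (b * g n) (begin
  a * g (suc n) + b * g n   ≡⟨ eq (suc n) ⟩
  a * h (suc n) + b * h n   ≡⟨ cong (λ z → a * h (suc n) + b * z) (lin-cancel a≢0 eq n) ⟨
  a * h (suc n) + b * g n   ∎))
  where open ≡-Reasoning

lin-identity : ∀ h → lin 1ℚ 0ℚ h ≗ h
lin-identity h zero    = *-identityˡ (h 0)
lin-identity h (suc n) = simplify (h (suc n)) (h n)
  where
  simplify : ∀ x y → 1ℚ * x + 0ℚ * y ≡ x
  simplify = solve-∀ ℚ-ring

·ₛ-cong : ∀ {f f′ g g′} → f ≗ f′ → g ≗ g′ → f ·ₛ g ≗ f′ ·ₛ g′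
·ₛ-cong f≗ g≗ n = Σ-cong′ (suc n) (λ k → cong₂ _*_ (f≗ k) (g≗ (n ∸ k)))

·ₛ-congˡ : ∀ {f f′} → f ≗ f′ → ∀ g → f ·ₛ g ≗ f′ ·ₛ g
·ₛ-congˡ f≗ g = ·ₛ-cong {g = g} f≗ (λ _ → refl)

·ₛ-congʳ : ∀ f {g g′} → g ≗ g′ → f ·ₛ g ≗ f ·ₛ g′
·ₛ-congʳ f g≗ = ·ₛ-cong {f} (λ _ → refl) g≗

·ₛ-comm : ∀ f g → f ·ₛ g ≗ g ·ₛ f
·ₛ-comm f g n = trans (Σ-reverse n (λ k → f k * g (n ∸ k))) (Σ-cong (suc n) λ {k} k≤n →
  trans (*-comm (f (n ∸ k)) _) (cong (λ i → g i * f (n ∸ k)) (ℕₚ.m∸[m∸n]≡n (ℕₚ.≤-pred k≤n))))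

·ₛ-suc : ∀ f g n → (f ·ₛ g) (suc n) ≡ f 0 * g (suc n) + Σ< (suc n) (λ k → f (suc k) * g (n ∸ k))
·ₛ-suc f g n = Σ-head (suc n) (λ k → f k * g (suc n ∸ k))

linear-·ₛ : ∀ {ω a b} → Linear ω a b → ∀ h → ω ·ₛ h ≗ lin a b h
linear-·ₛ ω≗ h zero = trans (+-identityˡ _) (cong (_* h 0) (ω≗ 0))
linear-·ₛ {ω} {a} {b} ω≗ h (suc n) = begin
  (ω ·ₛ h) (suc n)
    ≡⟨ ·ₛ-suc ω h n ⟩
  ω 0 * h (suc n) + Σ< (suc n) (λ k → ω (suc k) * h (n ∸ k))
    ≡⟨ cong (ω 0 * h (suc n) +_) (Σ-head n (λ k → ω (suc k) * h (n ∸ k))) ⟩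
  ω 0 * h (suc n) + (ω 1 * h n + Σ< n (λ k → ω (suc (suc k)) * h (n ∸ suc k)))
    ≡⟨ cong (λ z → ω 0 * h (suc n) + (ω 1 * h n + z)) (Σ-zero n λ {k} _ →
         trans (cong (_* h (n ∸ suc k)) (ω≗ (suc (suc k)))) (*-zeroˡ (h (n ∸ suc k)))) ⟩
  ω 0 * h (suc n) + (ω 1 * h n + 0ℚ)
    ≡⟨ cong₂ (λ x y → x * h (suc n) + (y * h n + 0ℚ)) (ω≗ 0) (ω≗ 1) ⟩
  a * h (suc n) + (b * h n + 0ℚ)
    ≡⟨ cong (a * h (suc n) +_) (+-identityʳ _) ⟩
  lin a b h (suc n) ∎
  where open ≡-Reasoning

·ₛ-linear : ∀ {ω a b} → Linear ω a b → ∀ h → h ·ₛ ω ≗ lin a b h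
·ₛ-linear {ω} ω≗ h n = trans (·ₛ-comm h ω n) (linear-·ₛ ω≗ h n)

·ₛ-identityʳ : ∀ f → f ·ₛ const 1ℚ ≗ f
·ₛ-identityʳ f n = trans (·ₛ-linear (const-linear 1ℚ) f n) (lin-identity f n)

·ₛ-const : ∀ c h → h ·ₛ const c ≗ λ n → c * h n
·ₛ-const c h n = trans (·ₛ-linear (const-linear c) h n) (lin-const c h n)

·ₛ-lin : ∀ a b f g → f ·ₛ lin a b g ≗ lin a b (f ·ₛ g)
·ₛ-lin a b f g zero = distrib a (f 0) (g 0)
  where
  distrib : ∀ a x y → 0ℚ + x * (a * y) ≡ a * (0ℚ + x * y)
  distrib = solve-∀ ℚ-ring
·ₛ-lin a b f g (suc n) = begin
  Σ< (suc n) (λ k → f k * lin a b g (suc n ∸ k)) + f (suc n) * lin a b g (n ∸ n)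
    ≡⟨ cong₂ _+_ (Σ-cong (suc n) λ k≤n → cong (f _ *_) (lin-suc∸ (ℕₚ.≤-pred k≤n)))
                 (cong (λ i → f (suc n) * lin a b g i) (ℕₚ.n∸n≡0 n)) ⟩
  Σ< (suc n) (λ k → f k * (a * g (suc n ∸ k) + b * g (n ∸ k))) + f (suc n) * (a * g 0)
    ≡⟨ cong (_+ f (suc n) * (a * g 0)) (trans (Σ-cong′ (suc n) λ k → distrib a b (f k) _ _)
         (trans (Σ-+ (suc n) _ _) (cong₂ _+_ (Σ-* (suc n) a _) (Σ-* (suc n) b _)))) ⟩
  a * X + b * Y + f (suc n) * (a * g 0)
    ≡⟨ regroup a b X Y (f (suc n)) (g 0) ⟩
  a * (X + f (suc n) * g 0) + b * Y
    ≡⟨ cong (λ i → a * (X + f (suc n) * g i) + b * Y) (ℕₚ.n∸n≡0 n) ⟨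
  lin a b (f ·ₛ g) (suc n) ∎
  where
  open ≡-Reasoning
  X = Σ< (suc n) (λ k → f k * g (suc n ∸ k))
  Y = Σ< (suc n) (λ k → f k * g (n ∸ k))
  lin-suc∸ : ∀ {k} → k ≤ n → lin a b g (suc n ∸ k) ≡ a * g (suc n ∸ k) + b * g (n ∸ k)
  lin-suc∸ k≤n rewrite ℕₚ.+-∸-assoc 1 k≤n = refl
  distrib : ∀ a b p x y → p * (a * x + b * y) ≡ a * (p * x) + b * (p * y)
  distrib = solve-∀ ℚ-ring
  regroup : ∀ a b x y z w → a * x + b * y + z * (a * w) ≡ a * (x + z * w) + b * y
  regroup = solve-∀ ℚ-ring

lin-·ₛ : ∀ a b f g → lin a b f ·ₛ g ≗ lin a b (f ·ₛ g)
lin-·ₛ a b f g n = begin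
  (lin a b f ·ₛ g) n   ≡⟨ ·ₛ-comm (lin a b f) g n ⟩
  (g ·ₛ lin a b f) n   ≡⟨ ·ₛ-lin a b g f n ⟩
  lin a b (g ·ₛ f) n   ≡⟨ lin-cong a b (·ₛ-comm g f) n ⟩
  lin a b (f ·ₛ g) n   ∎
  where open ≡-Reasoning

invVec-lookup : ∀ f n (i : Fin (suc n)) → Vec.lookup (invVec f n) i ≡ invₛ f (n ∸ toℕ i)
invVec-lookup f zero    Fin.zero    = refl
invVec-lookup f (suc n) Fin.zero    = refl
invVec-lookup f (suc n) (Fin.suc i) = invVec-lookup f n i

foldr-zipWith-tabulate : ∀ n (g b : ℕ → ℚ) (bs : Vec ℚ n) → (∀ i → Vec.lookup bs i ≡ b (toℕ i)) →
  Vec.foldr _ _+_ 0ℚ (Vec.zipWith _*_ (Vec.tabulate (g ∘ toℕ)) bs) ≡ Σ< n (λ k → g k * b k)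
foldr-zipWith-tabulate zero    g b Vec.[]       eq = refl
foldr-zipWith-tabulate (suc n) g b (x Vec.∷ bs) eq = begin
  g 0 * x + Vec.foldr _ _+_ 0ℚ (Vec.zipWith _*_ (Vec.tabulate (g ∘ suc ∘ toℕ)) bs)
    ≡⟨ cong₂ (λ y z → g 0 * y + z) (eq Fin.zero) (foldr-zipWith-tabulate n (g ∘ suc) (b ∘ suc) bs (eq ∘ Fin.suc)) ⟩
  g 0 * b 0 + Σ< n (λ k → g (suc k) * b (suc k))
    ≡⟨ Σ-head n (λ k → g k * b k) ⟨
  Σ< (suc n) (λ k → g k * b k) ∎
  where open ≡-Reasoning

invₛ-suc : ∀ f n → invₛ f (suc n) ≡ - (inv0 (f 0) * Σ< (suc n) (λ k → f (suc k) * invₛ f (n ∸ k)))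
invₛ-suc f n = cong (λ s → - (inv0 (f 0) * s))
  (foldr-zipWith-tabulate (suc n) (f ∘ suc) (λ k → invₛ f (n ∸ k)) (invVec f n) (invVec-lookup f n))

·ₛ-invₛ : ∀ {f} → f 0 ≢ 0ℚ → f ·ₛ invₛ f ≗ const 1ℚ
·ₛ-invₛ {f} f₀≢0 zero = trans (+-identityˡ _) (*-inv0 (f 0) f₀≢0)
·ₛ-invₛ {f} f₀≢0 (suc n) = begin
  (f ·ₛ invₛ f) (suc n)                  ≡⟨ ·ₛ-suc f (invₛ f) n ⟩
  f 0 * invₛ f (suc n) + S               ≡⟨ cong (λ y → f 0 * y + S) (invₛ-suc f n) ⟩
  f 0 * - (inv0 (f 0) * S) + S           ≡⟨ factor (f 0) (inv0 (f 0)) S ⟩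
  (1ℚ - f 0 * inv0 (f 0)) * S            ≡⟨ cong (λ y → (1ℚ - y) * S) (*-inv0 (f 0) f₀≢0) ⟩
  (1ℚ - 1ℚ) * S                          ≡⟨ *-zeroˡ S ⟩
  0ℚ                                     ∎
  where
  open ≡-Reasoning
  S = Σ< (suc n) (λ k → f (suc k) * invₛ f (n ∸ k))
  factor : ∀ a i s → a * - (i * s) + s ≡ (1ℚ - a * i) * s
  factor = solve-∀ ℚ-ring

·ₛ-cancelˡ : ∀ {f g h} → f 0 ≢ 0ℚ → f ·ₛ g ≗ f ·ₛ h → g ≗ h
·ₛ-cancelˡ {f} {g} {h} f₀≢0 eq n = upTo n n ℕₚ.≤-refl
  where
  open ≡-Reasoning
  upTo : ∀ n k → k ≤ n → g k ≡ h k
  upTo zero zero _ = *-cancelˡ f₀≢0 (begin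
    f 0 * g 0          ≡⟨ +-identityˡ _ ⟨
    (f ·ₛ g) 0         ≡⟨ eq 0 ⟩
    (f ·ₛ h) 0         ≡⟨ +-identityˡ _ ⟩
    f 0 * h 0          ∎)
  upTo (suc n) k k≤1+n with ℕₚ.m≤n⇒m<n∨m≡n k≤1+n
  ... | inj₁ k<1+n = upTo n k (ℕₚ.≤-pred k<1+n)
  ... | inj₂ refl  = *-cancelˡ f₀≢0 (+-cancelʳ S (begin
    f 0 * g (suc n) + S                                          ≡⟨ ·ₛ-suc f g n ⟨
    (f ·ₛ g) (suc n)                                             ≡⟨ eq (suc n) ⟩
    (f ·ₛ h) (suc n)                                             ≡⟨ ·ₛ-suc f h n ⟩
    f 0 * h (suc n) + Σ< (suc n) (λ k → f (suc k) * h (n ∸ k))   ≡⟨ cong (f 0 * h (suc n) +_) earlier ⟨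
    f 0 * h (suc n) + S                                          ∎))
    where
    S = Σ< (suc n) (λ k → f (suc k) * g (n ∸ k))
    earlier : S ≡ Σ< (suc n) (λ k → f (suc k) * h (n ∸ k))
    earlier = Σ-cong′ (suc n) (λ k → cong (f (suc k) *_) (upTo n (n ∸ k) (ℕₚ.m∸n≤m n k)))

lin-·ₛ-invₛ : ∀ {d₀} d₁ N → d₀ ≢ 0ℚ → lin d₀ d₁ (N ·ₛ invₛ (poly (d₀ ∷ d₁ ∷ []))) ≗ N
lin-·ₛ-invₛ {d₀} d₁ N d₀≢0 n = begin
  lin d₀ d₁ (N ·ₛ invₛ D) n      ≡⟨ ·ₛ-lin d₀ d₁ N (invₛ D) n ⟨
  (N ·ₛ lin d₀ d₁ (invₛ D)) n    ≡⟨ ·ₛ-congʳ N (λ k → trans (sym (linear-·ₛ (λ _ → refl) (invₛ D) k)) (·ₛ-invₛ {D} d₀≢0 k)) n ⟩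
  (N ·ₛ const 1ℚ) n              ≡⟨ ·ₛ-identityʳ N n ⟩
  N n                            ∎
  where
  open ≡-Reasoning
  D = poly (d₀ ∷ d₁ ∷ [])

powₛ-one : ∀ ω → powₛ ω 1 ≗ ω
powₛ-one ω n = trans (linear-·ₛ (const-linear 1ℚ) ω n) (lin-identity ω n)

powₛ-≢0 : ∀ {ω} → ω 0 ≢ 0ℚ → ∀ n → powₛ ω n 0 ≢ 0ℚ
powₛ-≢0 ω₀≢0 zero    = 1≢0
powₛ-≢0 ω₀≢0 (suc n) = *-≢0 (powₛ-≢0 ω₀≢0 n) ω₀≢0 ∘ trans (sym (+-identityˡ _))

-- Both sides are inverse to ω^(j+1), since ω^(j+1) · (a + b x) = ω^(j+2).
invₛ-powₛ-suc : ∀ {ω a b} → Linear ω a b → a ≢ 0ℚ → ∀ j →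
  invₛ (powₛ ω (suc j)) ≗ lin a b (invₛ (powₛ ω (suc (suc j))))
invₛ-powₛ-suc {ω} {a} {b} ω≗ a≢0 j = ·ₛ-cancelˡ {P} (powₛ-≢0 ω₀≢0 (suc j)) λ n → begin
  (P ·ₛ invₛ P) n                 ≡⟨ ·ₛ-invₛ {P} (powₛ-≢0 ω₀≢0 (suc j)) n ⟩
  const 1ℚ n                      ≡⟨ ·ₛ-invₛ {P′} (powₛ-≢0 ω₀≢0 (suc (suc j))) n ⟨
  ((P ·ₛ ω) ·ₛ invₛ P′) n         ≡⟨ ·ₛ-congˡ (·ₛ-linear ω≗ P) (invₛ P′) n ⟩
  (lin a b P ·ₛ invₛ P′) n        ≡⟨ lin-·ₛ a b P (invₛ P′) n ⟩
  lin a b (P ·ₛ invₛ P′) n        ≡⟨ ·ₛ-lin a b P (invₛ P′) n ⟨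
  (P ·ₛ lin a b (invₛ P′)) n      ∎
  where
  open ≡-Reasoning
  P  = powₛ ω (suc j)
  P′ = powₛ ω (suc (suc j))
  ω₀≢0 : ω 0 ≢ 0ℚ
  ω₀≢0 = a≢0 ∘ trans (sym (ω≗ 0))

-- The recurrence satisfied by T(α | a + b x), written without dividing by a.
record Riordan (a b : ℚ) (L : Mat) : Set where
  field
    step : ∀ i j → L i j ≡ a * L (suc i) (suc j) + b * L i (suc j)
    top  : ∀ j → L 0 (suc j) ≡ 0ℚ

col : ℕ → Mat → PS
col j L i = L i j

shiftₛ-suc : ∀ j g i → shiftₛ (suc j) g (suc i) ≡ shiftₛ j g i
shiftₛ-suc j g i with j ≤? i | suc j ≤? suc i
... | yes _   | yes _   = refl
... | no _    | no _    = refl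
... | yes j≤i | no j≰i  = contradiction (s≤s j≤i) j≰i
... | no j≰i  | yes j≤i = contradiction (s≤s⁻¹ j≤i) j≰i

shiftₛ-lin : ∀ {a b} j {g h} → g ≗ lin a b h → ∀ i →
  shiftₛ j g i ≡ a * shiftₛ (suc j) h (suc i) + b * shiftₛ (suc j) h i
shiftₛ-lin {a} {b} zero {h = h} g≗ zero = trans (g≗ 0) (pad a b (h 0))
  where
  pad : ∀ a b x → a * x ≡ a * x + b * 0ℚ
  pad = solve-∀ ℚ-ring
shiftₛ-lin zero g≗ (suc i) = g≗ (suc i)
shiftₛ-lin {a} {b} (suc j) {h = h} g≗ zero =
  trans (zeros a b) (cong (λ x → a * x + b * 0ℚ) (sym (shiftₛ-suc (suc j) h 0)))
  where
  zeros : ∀ a b → 0ℚ ≡ a * 0ℚ + b * 0ℚ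
  zeros = solve-∀ ℚ-ring
shiftₛ-lin {a} {b} (suc j) {g} {h} g≗ (suc i) = begin
  shiftₛ (suc j) g (suc i)                                      ≡⟨ shiftₛ-suc j g i ⟩
  shiftₛ j g i                                                  ≡⟨ shiftₛ-lin j g≗ i ⟩
  a * shiftₛ (suc j) h (suc i) + b * shiftₛ (suc j) h i         ≡⟨ cong₂ (λ x y → a * x + b * y)
                                                                     (shiftₛ-suc (suc j) h (suc i)) (shiftₛ-suc (suc j) h i) ⟨
  a * shiftₛ (suc (suc j)) h (suc (suc i)) + b * shiftₛ (suc (suc j)) h (suc i) ∎
  where open ≡-Reasoning

Riordan-T : ∀ {ω a b} α → Linear ω a b → a ≢ 0ℚ → Riordan a b (T α ω)
Riordan-T {ω} {a} {b} α ω≗ a≢0 = record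
  { step = λ i j → shiftₛ-lin j (column-step j) i
  ; top  = λ j → refl
  }
  where
  column-step : ∀ j → α ·ₛ invₛ (powₛ ω (suc j)) ≗ lin a b (α ·ₛ invₛ (powₛ ω (suc (suc j))))
  column-step j n = trans (·ₛ-congʳ α (invₛ-powₛ-suc ω≗ a≢0 j) n) (·ₛ-lin a b α _ n)

lin-col₀-T : ∀ {ω a b} α → Linear ω a b → a ≢ 0ℚ → lin a b (col 0 (T α ω)) ≗ α
lin-col₀-T {ω} {a} {b} α ω≗ a≢0 n = begin
  lin a b (α ·ₛ invₛ (powₛ ω 1)) n       ≡⟨ ·ₛ-lin a b α _ n ⟨
  (α ·ₛ lin a b (invₛ (powₛ ω 1))) n     ≡⟨ ·ₛ-congʳ α ω-inverse n ⟩
  (α ·ₛ const 1ℚ) n                      ≡⟨ ·ₛ-identityʳ α n ⟩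
  α n                                    ∎
  where
  open ≡-Reasoning
  ω₁≢0 : powₛ ω 1 0 ≢ 0ℚ
  ω₁≢0 = powₛ-≢0 {ω} (a≢0 ∘ trans (sym (ω≗ 0))) 1
  ω-inverse : lin a b (invₛ (powₛ ω 1)) ≗ const 1ℚ
  ω-inverse k = begin
    lin a b (invₛ (powₛ ω 1)) k            ≡⟨ linear-·ₛ ω≗ (invₛ (powₛ ω 1)) k ⟨
    (ω ·ₛ invₛ (powₛ ω 1)) k               ≡⟨ ·ₛ-congˡ (powₛ-one ω) (invₛ (powₛ ω 1)) k ⟨
    (powₛ ω 1 ·ₛ invₛ (powₛ ω 1)) k        ≡⟨ ·ₛ-invₛ {powₛ ω 1} ω₁≢0 k ⟩
    const 1ℚ k                             ∎

col₀-T-·ₛ : ∀ {ω a b} Y → Linear ω a b → a ≢ 0ℚ → col 0 (T (Y ·ₛ ω) ω) ≗ Y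
col₀-T-·ₛ {ω} Y ω≗ a≢0 = lin-cancel a≢0 λ n →
  trans (lin-col₀-T (Y ·ₛ ω) ω≗ a≢0 n) (·ₛ-linear ω≗ Y n)

infixl 7 _▷_
_▷_ : Mat → PS → PS
(A ▷ v) i = Σ< (suc i) (λ k → A i k * v k)

▷-cong : ∀ A {v w} → v ≗ w → A ▷ v ≗ A ▷ w
▷-cong A v≗w i = Σ-cong′ (suc i) (λ k → cong (A i k *_) (v≗w k))

▷-combination : ∀ A c d v w i → (A ▷ (λ k → c * v k + d * w k)) i ≡ c * (A ▷ v) i + d * (A ▷ w) i
▷-combination A c d v w i = begin
  Σ< (suc i) (λ k → A i k * (c * v k + d * w k))             ≡⟨ Σ-cong′ (suc i) (λ k → distrib c d (A i k) (v k) (w k)) ⟩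
  Σ< (suc i) (λ k → c * (A i k * v k) + d * (A i k * w k))   ≡⟨ Σ-+ (suc i) _ _ ⟩
  _                                                          ≡⟨ cong₂ _+_ (Σ-* (suc i) c _) (Σ-* (suc i) d _) ⟩
  c * (A ▷ v) i + d * (A ▷ w) i                              ∎
  where
  open ≡-Reasoning
  distrib : ∀ c d x y z → x * (c * y + d * z) ≡ c * (x * y) + d * (x * z)
  distrib = solve-∀ ℚ-ring

▷-δ : ∀ A i → (A ▷ const 1ℚ) i ≡ A i 0
▷-δ A i = begin
  (A ▷ const 1ℚ) i                              ≡⟨ Σ-head i _ ⟩
  A i 0 * 1ℚ + Σ< i (λ k → A i (suc k) * 0ℚ)    ≡⟨ cong₂ _+_ (*-identityʳ (A i 0)) (Σ-zero i (λ {k} _ → *-zeroʳ (A i (suc k)))) ⟩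
  A i 0 + 0ℚ                                    ≡⟨ +-identityʳ (A i 0) ⟩
  A i 0                                         ∎
  where open ≡-Reasoning

▷-x-suc : ∀ A w i → (A ▷ shiftₛ 1 w) (suc i) ≡ Σ< (suc i) (λ k → A (suc i) (suc k) * w k)
▷-x-suc A w i = begin
  (A ▷ shiftₛ 1 w) (suc i)                      ≡⟨ Σ-head (suc i) _ ⟩
  A (suc i) 0 * 0ℚ + S                          ≡⟨ cong (_+ S) (*-zeroʳ (A (suc i) 0)) ⟩
  0ℚ + S                                        ≡⟨ +-identityˡ S ⟩
  S                                             ∎
  where
  open ≡-Reasoning
  S = Σ< (suc i) (λ k → A (suc i) (suc k) * w k)

combination-lin : ∀ d₀ d₁ v → (λ k → d₀ * v k + d₁ * shiftₛ 1 v k) ≗ lin d₀ d₁ v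
combination-lin d₀ d₁ v zero    = drop (v 0) d₀ d₁
  where
  drop : ∀ x d₀ d₁ → d₀ * x + d₁ * 0ℚ ≡ d₀ * x
  drop = solve-∀ ℚ-ring
combination-lin d₀ d₁ v (suc k) = refl

poly-lin : ∀ n₀ n₁ → poly (n₀ ∷ n₁ ∷ []) ≗ lin n₀ n₁ (const 1ℚ)
poly-lin n₀ n₁ zero          = sym (*-identityʳ n₀)
poly-lin n₀ n₁ (suc zero)    = first n₀ n₁
  where
  first : ∀ n₀ n₁ → n₁ ≡ n₀ * 0ℚ + n₁ * 1ℚ
  first = solve-∀ ℚ-ring
poly-lin n₀ n₁ (suc (suc k)) = zeros n₀ n₁
  where
  zeros : ∀ n₀ n₁ → 0ℚ ≡ n₀ * 0ℚ + n₁ * 0ℚ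
  zeros = solve-∀ ℚ-ring

module _ {a b L} (R : Riordan a b L) (a≢0 : a ≢ 0ℚ) where
  open Riordan R

  Riordan-upper : ∀ {i j} → i < j → L i j ≡ 0ℚ
  Riordan-upper {zero}  {suc j} _         = top j
  Riordan-upper {suc i} {suc j} (s≤s i<j) = *-cancelˡ a≢0 (+-cancelʳ (b * L i (suc j)) (begin
    a * L (suc i) (suc j) + b * L i (suc j)   ≡⟨ step i j ⟨
    L i j                                     ≡⟨ Riordan-upper i<j ⟩
    0ℚ                                        ≡⟨ zeros a b ⟩
    a * 0ℚ + b * 0ℚ                           ≡⟨ cong (λ x → a * 0ℚ + b * x) (Riordan-upper (ℕₚ.m<n⇒m<1+n i<j)) ⟨
    a * 0ℚ + b * L i (suc j)                  ∎))
    where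
    open ≡-Reasoning
    zeros : ∀ a b → 0ℚ ≡ a * 0ℚ + b * 0ℚ
    zeros = solve-∀ ℚ-ring

  Riordan-unique : ∀ {L′} → Riordan a b L′ → col 0 L ≗ col 0 L′ → L ≋ L′
  Riordan-unique {L′} R′ col₀≗ i j = by-column j i
    where
    module R′ = Riordan R′
    open ≡-Reasoning
    by-column : ∀ j i → L i j ≡ L′ i j
    by-column zero    i       = col₀≗ i
    by-column (suc j) zero    = trans (top j) (sym (R′.top j))
    by-column (suc j) (suc i) = *-cancelˡ a≢0 (+-cancelʳ (b * L i (suc j)) (begin
      a * L (suc i) (suc j) + b * L i (suc j)     ≡⟨ step i j ⟨
      L i j                                       ≡⟨ by-column j i ⟩
      L′ i j                                      ≡⟨ R′.step i j ⟩
      a * L′ (suc i) (suc j) + b * L′ i (suc j)   ≡⟨ cong (λ x → a * L′ (suc i) (suc j) + b * x) (by-column (suc j) i) ⟨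
      a * L′ (suc i) (suc j) + b * L i (suc j)    ∎))

  ▷-x : ∀ w i → (L ▷ shiftₛ 1 w) i ≡ Σ< (suc i) (λ k → L i (suc k) * w k)
  ▷-x w i = begin
    (L ▷ shiftₛ 1 w) i
      ≡⟨ Σ-head i _ ⟩
    L i 0 * 0ℚ + S
      ≡⟨ cong (_+ S) (*-zeroʳ (L i 0)) ⟩
    0ℚ + S
      ≡⟨ +-identityˡ S ⟩
    S
      ≡⟨ +-identityʳ S ⟨
    S + 0ℚ
      ≡⟨ cong (S +_) (trans (sym (*-zeroˡ (w i))) (cong (_* w i) (sym (Riordan-upper (ℕₚ.n<1+n i))))) ⟩
    S + L i (suc i) * w i ∎
    where
    open ≡-Reasoning
    S = Σ< i (λ k → L i (suc k) * w k)

  ▷-shift : ∀ w i → (L ▷ w) i ≡ a * (L ▷ shiftₛ 1 w) (suc i) + b * (L ▷ shiftₛ 1 w) i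
  ▷-shift w i = begin
    (L ▷ w) i
      ≡⟨ Σ-cong′ (suc i) (λ k → trans (cong (_* w k) (step i k)) (distrib a b _ _ (w k))) ⟩
    Σ< (suc i) (λ k → a * (L (suc i) (suc k) * w k) + b * (L i (suc k) * w k))
      ≡⟨ trans (Σ-+ (suc i) _ _) (cong₂ _+_ (Σ-* (suc i) a _) (Σ-* (suc i) b _)) ⟩
    a * Σ< (suc i) (λ k → L (suc i) (suc k) * w k) + b * Σ< (suc i) (λ k → L i (suc k) * w k)
      ≡⟨ cong₂ (λ x y → a * x + b * y) (▷-x-suc L w i) (▷-x w i) ⟨
    a * (L ▷ shiftₛ 1 w) (suc i) + b * (L ▷ shiftₛ 1 w) i ∎
    where
    open ≡-Reasoning
    distrib : ∀ a b x y z → (a * x + b * y) * z ≡ a * (x * z) + b * (y * z)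
    distrib = solve-∀ ℚ-ring

  Riordan-⊙ : ∀ {c d B} → Riordan c d B → Riordan (c * a) (c * b + d) (L ⊙ B)
  Riordan-⊙ {c} {d} {B} RB = record { step = step⊙ ; top = top⊙ }
    where
    module RB = Riordan RB
    open ≡-Reasoning
    step⊙ : ∀ i j → (L ⊙ B) i j ≡ c * a * (L ⊙ B) (suc i) (suc j) + (c * b + d) * (L ⊙ B) i (suc j)
    step⊙ i j = begin
      (L ▷ col j B) i
        ≡⟨ ▷-cong L (λ k → RB.step k j) i ⟩
      (L ▷ (λ k → c * w k + d * B k (suc j))) i
        ≡⟨ ▷-combination L c d w (col (suc j) B) i ⟩
      c * (L ▷ w) i + d * X₀
        ≡⟨ cong (λ z → c * z + d * X₀) (▷-shift w i) ⟩
      c * (a * (L ▷ shiftₛ 1 w) (suc i) + b * (L ▷ shiftₛ 1 w) i) + d * X₀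
        ≡⟨ cong₂ (λ x y → c * (a * x + b * y) + d * X₀) (▷-cong L x·w≗ (suc i)) (▷-cong L x·w≗ i) ⟩
      c * (a * X₁ + b * X₀) + d * X₀
        ≡⟨ regroup a b c d X₁ X₀ ⟩
      c * a * X₁ + (c * b + d) * X₀ ∎
      where
      w : PS
      w k = B (suc k) (suc j)
      X₀ = (L ⊙ B) i (suc j)
      X₁ = (L ⊙ B) (suc i) (suc j)
      x·w≗ : shiftₛ 1 w ≗ col (suc j) B
      x·w≗ zero    = sym (RB.top j)
      x·w≗ (suc k) = refl
      regroup : ∀ a b c d x y → c * (a * x + b * y) + d * y ≡ c * a * x + (c * b + d) * y
      regroup = solve-∀ ℚ-ring
    top⊙ : ∀ j → (L ⊙ B) 0 (suc j) ≡ 0ℚ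
    top⊙ j = trans (cong (λ z → 0ℚ + L 0 0 * z) (RB.top j)) (vanish (L 0 0))
      where
      vanish : ∀ x → 0ℚ + x * 0ℚ ≡ 0ℚ
      vanish = solve-∀ ℚ-ring

  -- For v = (n₀ + n₁ x) / (d₀ + d₁ x) and ω = a + b x: L ▷ v = (col 0 L) · (n₀ ω + n₁ x) / (d₀ ω + d₁ x).
  ▷-column : ∀ {v d₀ d₁ n₀ n₁} → lin d₀ d₁ v ≗ poly (n₀ ∷ n₁ ∷ []) →
    lin (d₀ * a) (d₀ * b + d₁) (L ▷ v) ≗ lin (n₀ * a) (n₀ * b + n₁) (col 0 L)
  ▷-column {v} {d₀} {d₁} {n₀} {n₁} Dv≗N = λ
    { zero    → begin
        d₀ * a * t 0                    ≡⟨ recombine₀ a d₀ d₁ (t 0) ⟩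
        a * (d₀ * t 0 + d₁ * 0ℚ)        ≡⟨ cong (λ z → a * (d₀ * t 0 + d₁ * z)) (vanish (L 0 0)) ⟨
        a * (d₀ * t 0 + d₁ * U 0)       ≡⟨ cong (a *_) (relation 0) ⟩
        a * (n₀ * C₀ 0 + n₁ * E 0)       ≡⟨ cong (λ z → a * (n₀ * C₀ 0 + n₁ * z)) (vanish (L 0 0)) ⟩
        a * (n₀ * C₀ 0 + n₁ * 0ℚ)        ≡⟨ recombine₀ a n₀ n₁ (C₀ 0) ⟨
        n₀ * a * C₀ 0                    ∎
    ; (suc i) → begin
        d₀ * a * t (suc i) + (d₀ * b + d₁) * t i
          ≡⟨ recombine {d₀} {d₁} (▷-shift v i) ⟩
        a * (d₀ * t (suc i) + d₁ * U (suc i)) + b * (d₀ * t i + d₁ * U i)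
          ≡⟨ cong₂ (λ x y → a * x + b * y) (relation (suc i)) (relation i) ⟩
        a * (n₀ * C₀ (suc i) + n₁ * E (suc i)) + b * (n₀ * C₀ i + n₁ * E i)
          ≡⟨ recombine {n₀} {n₁} (trans (sym (▷-δ L i)) (▷-shift (const 1ℚ) i)) ⟨
        n₀ * a * C₀ (suc i) + (n₀ * b + n₁) * C₀ i ∎
    }
    where
    open ≡-Reasoning
    t U C₀ E : PS
    t = L ▷ v
    U = L ▷ shiftₛ 1 v
    C₀ = col 0 L
    E = L ▷ shiftₛ 1 (const 1ℚ)
    relation : ∀ i → d₀ * t i + d₁ * U i ≡ n₀ * C₀ i + n₁ * E i
    relation i = begin
      d₀ * t i + d₁ * U i
        ≡⟨ ▷-combination L d₀ d₁ v _ i ⟨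
      (L ▷ (λ k → d₀ * v k + d₁ * shiftₛ 1 v k)) i
        ≡⟨ ▷-cong L (λ k → trans (combination-lin d₀ d₁ v k) (Dv≗N k)) i ⟩
      (L ▷ poly (n₀ ∷ n₁ ∷ [])) i
        ≡⟨ ▷-cong L (λ k → trans (poly-lin n₀ n₁ k) (sym (combination-lin n₀ n₁ _ k))) i ⟩
      (L ▷ (λ k → n₀ * const 1ℚ k + n₁ * shiftₛ 1 (const 1ℚ) k)) i
        ≡⟨ ▷-combination L n₀ n₁ _ _ i ⟩
      n₀ * (L ▷ const 1ℚ) i + n₁ * E i
        ≡⟨ cong (λ z → n₀ * z + n₁ * E i) (▷-δ L i) ⟩
      n₀ * C₀ i + n₁ * E i ∎
    vanish : ∀ x → 0ℚ + x * 0ℚ ≡ 0ℚ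
    vanish = solve-∀ ℚ-ring
    recombine₀ : ∀ a d₀ d₁ x → d₀ * a * x ≡ a * (d₀ * x + d₁ * 0ℚ)
    recombine₀ = solve-∀ ℚ-ring
    recombine′ : ∀ a b d₀ d₁ t′ u′ u → d₀ * a * t′ + (d₀ * b + d₁) * (a * u′ + b * u)
                                     ≡ a * (d₀ * t′ + d₁ * u′) + b * (d₀ * (a * u′ + b * u) + d₁ * u)
    recombine′ = solve-∀ ℚ-ring
    recombine : ∀ {d₀ d₁ t′ x u′ u} → x ≡ a * u′ + b * u →
      d₀ * a * t′ + (d₀ * b + d₁) * x ≡ a * (d₀ * t′ + d₁ * u′) + b * (d₀ * x + d₁ * u)
    recombine {d₀} {d₁} {t′} {u′ = u′} {u} refl = recombine′ a b d₀ d₁ t′ u′ u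

count : ∀ {V : Set} → ℕ → List (List V) → ℕ
count k = length ∘ filter (λ σ → length σ ℕ.≟ k)

indicator : ℕ → ℕ → ℕ
indicator ℓ k = if ℓ ≡ᵇ k then 1 else 0

count-∷ : ∀ {V : Set} k (σ : List V) Fs → count k (σ ∷ Fs) ≡ indicator (length σ) k ℕ.+ count k Fs
count-∷ k σ Fs with length σ ≡ᵇ k
... | true  = refl
... | false = refl

count-++ : ∀ {V : Set} k (Fs Gs : List (List V)) → count k (Fs ++ Gs) ≡ count k Fs ℕ.+ count k Gs
count-++ k Fs Gs = trans (cong length (List.filter-++ (λ σ → length σ ℕ.≟ k) Fs Gs)) (List.length-++ (filter _ Fs))

count-uniform : ∀ {X V : Set} k ℓ (h : X → List V) → (∀ x → length (h x) ≡ ℓ) →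
  ∀ xs → count k (map h xs) ≡ indicator ℓ k ℕ.* length xs
count-uniform k ℓ h len []       = sym (ℕₚ.*-zeroʳ (indicator ℓ k))
count-uniform k ℓ h len (x ∷ xs) = begin
  count k (h x ∷ map h xs)                         ≡⟨ count-∷ k (h x) (map h xs) ⟩
  indicator (length (h x)) k ℕ.+ count k (map h xs) ≡⟨ cong₂ (λ a b → indicator a k ℕ.+ b) (len x) (count-uniform k ℓ h len xs) ⟩
  indicator ℓ k ℕ.+ indicator ℓ k ℕ.* length xs    ≡⟨ ℕₚ.*-suc (indicator ℓ k) (length xs) ⟨
  indicator ℓ k ℕ.* suc (length xs)                ∎
  where open ≡-Reasoning

maxLength : ∀ {V : Set} → List (List V) → ℕ
maxLength = foldr _⊔_ 0 ∘ map length

maxLength-++ : ∀ {V : Set} (Fs Gs : List (List V)) → maxLength (Fs ++ Gs) ≡ maxLength Fs ⊔ maxLength Gs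
maxLength-++ []       Gs = refl
maxLength-++ (σ ∷ Fs) Gs = trans (cong (length σ ⊔_) (maxLength-++ Fs Gs)) (sym (ℕₚ.⊔-assoc (length σ) _ _))

maxLength-uniform : ∀ {X V : Set} ℓ (h : X → List V) → (∀ x → length (h x) ≡ ℓ) →
  ∀ x xs → maxLength (map h (x ∷ xs)) ≡ ℓ
maxLength-uniform ℓ h len x []        = trans (ℕₚ.⊔-identityʳ _) (len x)
maxLength-uniform ℓ h len x (x′ ∷ xs) = trans (cong₂ _⊔_ (len x) (maxLength-uniform ℓ h len x′ xs)) (ℕₚ.⊔-idem ℓ)

module Join {V : Set} (q : ℕ) where

  extend : List V → List (Fin q) → List (V ⊎ Fin q)
  extend σ τ = map inj₁ σ ++ map inj₂ τ

  block : List V → List (List (V ⊎ Fin q))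
  block σ = map (extend σ) (faces (pts q))

  length-extend : ∀ σ τ → length (extend σ τ) ≡ length σ ℕ.+ length τ
  length-extend σ τ = trans (List.length-++ (map inj₁ σ)) (cong₂ ℕ._+_ (List.length-map inj₁ σ) (List.length-map inj₂ τ))

  length-extend-[] : ∀ σ → length (extend σ []) ≡ length σ
  length-extend-[] σ = trans (length-extend σ []) (ℕₚ.+-identityʳ (length σ))

  length-extend-[v] : ∀ σ v → length (extend σ (v ∷ [])) ≡ suc (length σ)
  length-extend-[v] σ v = trans (length-extend σ (v ∷ [])) (ℕₚ.+-comm (length σ) 1)

  extensions : ∀ σ → block σ ≡ extend σ [] ∷ map (λ v → extend σ (v ∷ [])) (allFin q)
  extensions σ = cong (extend σ [] ∷_) (sym (List.map-∘ (allFin q)))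

  count-block : ∀ k σ → count k (block σ) ≡ indicator (length σ) k ℕ.+ indicator (suc (length σ)) k ℕ.* q
  count-block k σ = begin
    count k (block σ)
      ≡⟨ cong (count k) (extensions σ) ⟩
    count k (extend σ [] ∷ map (λ v → extend σ (v ∷ [])) (allFin q))
      ≡⟨ count-∷ k (extend σ []) _ ⟩
    indicator (length (extend σ [])) k ℕ.+ count k (map (λ v → extend σ (v ∷ [])) (allFin q))
      ≡⟨ cong₂ (λ ℓ c → indicator ℓ k ℕ.+ c) (length-extend-[] σ)
           (count-uniform k (suc (length σ)) _ (length-extend-[v] σ) (allFin q)) ⟩
    indicator (length σ) k ℕ.+ indicator (suc (length σ)) k ℕ.* length (allFin q)
      ≡⟨ cong (λ n → indicator (length σ) k ℕ.+ indicator (suc (length σ)) k ℕ.* n) (List.length-tabulate _) ⟩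
    indicator (length σ) k ℕ.+ indicator (suc (length σ)) k ℕ.* q ∎
    where open ≡-Reasoning

  count-join-zero : ∀ Fs → count 0 (concatMap block Fs) ≡ count 0 Fs
  count-join-zero []       = refl
  count-join-zero (σ ∷ Fs) = begin
    count 0 (block σ ++ concatMap block Fs)            ≡⟨ count-++ 0 (block σ) _ ⟩
    count 0 (block σ) ℕ.+ count 0 (concatMap block Fs) ≡⟨ cong₂ ℕ._+_ (trans (count-block 0 σ) (ℕₚ.+-identityʳ _)) (count-join-zero Fs) ⟩
    indicator (length σ) 0 ℕ.+ count 0 Fs              ≡⟨ count-∷ 0 σ Fs ⟨
    count 0 (σ ∷ Fs)                                   ∎
    where open ≡-Reasoning

  count-join-suc : ∀ k Fs → count (suc k) (concatMap block Fs) ≡ count (suc k) Fs ℕ.+ q ℕ.* count k Fs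
  count-join-suc k []       = sym (ℕₚ.*-zeroʳ q)
  count-join-suc k (σ ∷ Fs) = begin
    count (suc k) (block σ ++ concatMap block Fs)
      ≡⟨ count-++ (suc k) (block σ) _ ⟩
    count (suc k) (block σ) ℕ.+ count (suc k) (concatMap block Fs)
      ≡⟨ cong₂ ℕ._+_ (count-block (suc k) σ) (count-join-suc k Fs) ⟩
    (a ℕ.+ b ℕ.* q) ℕ.+ (c ℕ.+ q ℕ.* d)
      ≡⟨ regroup a b c d q ⟩
    (a ℕ.+ c) ℕ.+ q ℕ.* (b ℕ.+ d)
      ≡⟨ cong₂ (λ x y → x ℕ.+ q ℕ.* y) (count-∷ (suc k) σ Fs) (count-∷ k σ Fs) ⟨
    count (suc k) (σ ∷ Fs) ℕ.+ q ℕ.* count k (σ ∷ Fs) ∎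
    where
    open ≡-Reasoning
    a = indicator (length σ) (suc k)
    b = indicator (length σ) k
    c = count (suc k) Fs
    d = count k Fs
    regroup : ∀ a b c d q → (a ℕ.+ b ℕ.* q) ℕ.+ (c ℕ.+ q ℕ.* d) ≡ (a ℕ.+ c) ℕ.+ q ℕ.* (b ℕ.+ d)
    regroup = ℕ-Solver.solve-∀


module _ {V : Set} (q′ : ℕ) where
  open Join {V} (suc q′)

  maxLength-block : ∀ σ → maxLength (block σ) ≡ suc (length σ)
  maxLength-block σ = begin
    maxLength (block σ)
      ≡⟨ cong maxLength (extensions σ) ⟩
    length (extend σ []) ⊔ maxLength (map (λ v → extend σ (v ∷ [])) (allFin (suc q′)))
      ≡⟨ cong₂ _⊔_ (length-extend-[] σ) (maxLength-uniform _ (λ v → extend σ (v ∷ [])) (length-extend-[v] σ) Fin.zero (List.tabulate Fin.suc)) ⟩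
    length σ ⊔ suc (length σ)
      ≡⟨ ℕₚ.m≤n⇒m⊔n≡n (ℕₚ.n≤1+n (length σ)) ⟩
    suc (length σ) ∎
    where open ≡-Reasoning

  maxLength-join : ∀ σ Fs → maxLength (concatMap block (σ ∷ Fs)) ≡ suc (maxLength (σ ∷ Fs))
  maxLength-join σ []        = begin
    maxLength (block σ ++ [])       ≡⟨ maxLength-++ (block σ) [] ⟩
    maxLength (block σ) ⊔ 0         ≡⟨ ℕₚ.⊔-identityʳ _ ⟩
    maxLength (block σ)             ≡⟨ maxLength-block σ ⟩
    suc (length σ)                  ≡⟨ cong suc (ℕₚ.⊔-identityʳ _) ⟨
    suc (length σ ⊔ 0)              ∎
    where open ≡-Reasoning
  maxLength-join σ (σ′ ∷ Fs) = trans (maxLength-++ (block σ) _) (cong₂ _⊔_ (maxLength-block σ) (maxLength-join σ′ Fs))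

faces-Δ : ∀ m q n → ∃ λ Fs → faces (Δ m q n) ≡ [] ∷ Fs
faces-Δ m q zero    = _ , refl
faces-Δ m q (suc n) with faces-Δ m q n
... | Fs , eq = _ , cong (concatMap (Join.block q)) eq

rank-Δ : ∀ m′ q′ n → rank (Δ (suc m′) (suc q′) n) ≡ suc n
rank-Δ m′ q′ zero    = maxLength-uniform {X = Fin (suc m′)} 1 (λ v → v ∷ []) (λ _ → refl) Fin.zero (List.tabulate Fin.suc)
rank-Δ m′ q′ (suc n) with faces-Δ (suc m′) (suc q′) n
... | Fs , eq = begin
  maxLength (concatMap (Join.block (suc q′)) (faces (Δ (suc m′) (suc q′) n)))
    ≡⟨ cong (maxLength ∘ concatMap (Join.block (suc q′))) eq ⟩
  maxLength (concatMap (Join.block (suc q′)) ([] ∷ Fs))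
    ≡⟨ maxLength-join q′ [] Fs ⟩
  suc (maxLength ([] ∷ Fs))
    ≡⟨ cong (suc ∘ maxLength) eq ⟨
  suc (rank (Δ (suc m′) (suc q′) n))
    ≡⟨ cong suc (rank-Δ m′ q′ n) ⟩
  suc (suc n) ∎
  where open ≡-Reasoning

-- f_{k-1}(Δ^{(n)}): [m] has f-polynomial 1 + m x, and the join with [q] multiplies it by 1 + q x.
fΔ : ℕ → ℕ → ℕ → ℕ → ℕ
fΔ m q zero    zero          = 1
fΔ m q zero    (suc zero)    = m
fΔ m q zero    (suc (suc k)) = 0
fΔ m q (suc n) zero          = 1
fΔ m q (suc n) (suc k)       = fΔ m q n (suc k) ℕ.+ q ℕ.* fΔ m q n k

fΔ-zero : ∀ m q n → fΔ m q n 0 ≡ 1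
fΔ-zero m q zero    = refl
fΔ-zero m q (suc n) = refl

fΔ-vanish : ∀ m q n {k} → suc n < k → fΔ m q n k ≡ 0
fΔ-vanish m q zero    {suc (suc k)} _         = refl
fΔ-vanish m q zero    {suc zero}    (s≤s ())
fΔ-vanish m q (suc n) {suc k}       (s≤s n<k) = trans
  (cong₂ (λ a b → a ℕ.+ q ℕ.* b) (fΔ-vanish m q n (ℕₚ.m<n⇒m<1+n n<k)) (fΔ-vanish m q n n<k))
  (ℕₚ.*-zeroʳ q)

fnum-Δ : ∀ m q n k → fnum (Δ m q n) k ≡ fΔ m q n k
fnum-Δ m q zero k = begin
  count k ([] ∷ map (λ v → v ∷ []) (allFin m))
    ≡⟨ count-∷ k [] _ ⟩
  indicator 0 k ℕ.+ count k (map (λ v → v ∷ []) (allFin m))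
    ≡⟨ cong (indicator 0 k ℕ.+_) (count-uniform k 1 _ (λ _ → refl) (allFin m)) ⟩
  indicator 0 k ℕ.+ indicator 1 k ℕ.* length (allFin m)
    ≡⟨ cong (λ n → indicator 0 k ℕ.+ indicator 1 k ℕ.* n) (List.length-tabulate _) ⟩
  indicator 0 k ℕ.+ indicator 1 k ℕ.* m
    ≡⟨ points k ⟩
  fΔ m q zero k ∎
  where
  open ≡-Reasoning
  points : ∀ k → indicator 0 k ℕ.+ indicator 1 k ℕ.* m ≡ fΔ m q zero k
  points zero          = refl
  points (suc zero)    = ℕₚ.+-identityʳ m
  points (suc (suc k)) = refl
fnum-Δ m q (suc n) zero    =
  trans (Join.count-join-zero q (faces (Δ m q n))) (trans (fnum-Δ m q n 0) (fΔ-zero m q n))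
fnum-Δ m q (suc n) (suc k) =
  trans (Join.count-join-suc q k (faces (Δ m q n))) (cong₂ (λ a b → a ℕ.+ q ℕ.* b) (fnum-Δ m q n (suc k)) (fnum-Δ m q n k))

hWeight : ℕ → ℕ → ℕ → ℚ
hWeight R i k = sgn (k ∸ i) * ℕ→ℚ ((R ∸ i) C (k ∸ i))

-- h_k of a complex of rank R with face numbers g, with the binomial C(R-i, R-k) of hnum written as
-- C(R-i, k-i): the two agree for k ≤ R, and only the latter obeys Pascal's rule without truncation junk.
hT : ℕ → (ℕ → ℚ) → ℕ → ℚ
hT R g k = Σ< (suc k) (λ i → hWeight R i k * g i)

∸-∸-∸ : ∀ {R i k} → i ≤ k → (R ∸ i) ∸ (k ∸ i) ≡ R ∸ k
∸-∸-∸ {R}     {zero}  {k}     _         = refl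
∸-∸-∸ {zero}  {suc i} {suc k} _         = ℕₚ.0∸n≡0 (k ∸ i)
∸-∸-∸ {suc R} {suc i} {suc k} (s≤s i≤k) = ∸-∸-∸ {R} i≤k

hnum-hT : ∀ K k → k ≤ rank K → hnum K k ≡ hT (rank K) (ℕ→ℚ ∘ fnum K) k
hnum-hT K k k≤R = Σ-cong (suc k) λ {i} i<1+k → cong (λ c → sgn (k ∸ i) * ℕ→ℚ c * ℕ→ℚ (fnum K i)) (begin
  (R ∸ i) C (R ∸ k)                  ≡⟨ cong ((R ∸ i) C_) (∸-∸-∸ {R} (ℕₚ.≤-pred i<1+k)) ⟨
  (R ∸ i) C ((R ∸ i) ∸ (k ∸ i))      ≡⟨ nCk≡nC[n∸k] (ℕₚ.∸-monoˡ-≤ i k≤R) ⟨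
  (R ∸ i) C (k ∸ i)                  ∎)
  where
  open ≡-Reasoning
  R = rank K

hT-cong : ∀ R {g g′} → g ≗ g′ → ∀ k → hT R g k ≡ hT R g′ k
hT-cong R g≗g′ k = Σ-cong′ (suc k) (λ i → cong (hWeight R i k *_) (g≗g′ i))

hT-zero : ∀ R g → hT R g 0 ≡ g 0
hT-zero R g = simplify (g 0)
  where
  simplify : ∀ x → 0ℚ + 1ℚ * 1ℚ * x ≡ x
  simplify = solve-∀ ℚ-ring

hT-vanish : ∀ R g → (∀ {i} → R < i → g i ≡ 0ℚ) → ∀ {k} → R < k → hT R g k ≡ 0ℚ
hT-vanish R g g-vanish {k} R<k = Σ-zero (suc k) term-vanish
  where
  term-vanish : ∀ {i} → i < suc k → hWeight R i k * g i ≡ 0ℚ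
  term-vanish {i} _ = by-size (i ≤? R)
    where
    vanish : ∀ s x → s * 0ℚ * x ≡ 0ℚ
    vanish = solve-∀ ℚ-ring
    by-size : Dec (i ≤ R) → hWeight R i k * g i ≡ 0ℚ
    by-size (yes i≤R) = trans (cong (λ c → sgn (k ∸ i) * ℕ→ℚ c * g i) (k>n⇒nCk≡0 (ℕₚ.∸-monoˡ-< R<k i≤R))) (vanish (sgn (k ∸ i)) (g i))
    by-size (no i≰R)  = trans (cong (hWeight R i k *_) (g-vanish (ℕₚ.≰⇒> i≰R))) (*-zeroʳ (hWeight R i k))

hT-reindex : ∀ R Q {g g′} → g′ 0 ≡ g 0 → (∀ i → g′ (suc i) ≡ g (suc i) + Q * g i) →
  ∀ k → hT (suc R) g′ (suc k) ≡ hT (suc R) g (suc k) + Q * hT R g k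
hT-reindex R Q {g} {g′} g′₀ g′-suc k = begin
  hT (suc R) g′ (suc k)
    ≡⟨ Σ-head (suc k) (λ i → hWeight (suc R) i (suc k) * g′ i) ⟩
  w₀ * g′ 0 + Σ< (suc k) (λ i → hWeight R i k * g′ (suc i))
    ≡⟨ cong₂ (λ x y → w₀ * x + y) g′₀ (Σ-cong′ (suc k) λ i → trans (cong (hWeight R i k *_) (g′-suc i)) (distrib (hWeight R i k) _ Q _)) ⟩
  w₀ * g 0 + Σ< (suc k) (λ i → hWeight R i k * g (suc i) + Q * (hWeight R i k * g i))
    ≡⟨ cong (w₀ * g 0 +_) (trans (Σ-+ (suc k) _ _) (cong (Σ< (suc k) (λ i → hWeight R i k * g (suc i)) +_) (Σ-* (suc k) Q _))) ⟩
  w₀ * g 0 + (Σ< (suc k) (λ i → hWeight R i k * g (suc i)) + Q * hT R g k)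
    ≡⟨ +-assoc (w₀ * g 0) _ _ ⟨
  w₀ * g 0 + Σ< (suc k) (λ i → hWeight R i k * g (suc i)) + Q * hT R g k
    ≡⟨ cong (_+ Q * hT R g k) (Σ-head (suc k) (λ i → hWeight (suc R) i (suc k) * g i)) ⟨
  hT (suc R) g (suc k) + Q * hT R g k ∎
  where
  open ≡-Reasoning
  w₀ = hWeight (suc R) 0 (suc k)
  distrib : ∀ w x q y → w * (x + q * y) ≡ w * x + q * (w * y)
  distrib = solve-∀ ℚ-ring

hWeight-pascal : ∀ {R i k} → i ≤ k → k ≤ R → hWeight (suc R) i (suc k) + hWeight R i k ≡ hWeight R i (suc k)
hWeight-pascal {R} {i} {k} i≤k k≤R = begin
  sgn (suc k ∸ i) * ℕ→ℚ ((suc R ∸ i) C (suc k ∸ i)) + s * ℕ→ℚ (n C j)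
    ≡⟨ cong₂ (λ a b → sgn a * ℕ→ℚ (b C a) + s * ℕ→ℚ (n C j)) (ℕₚ.+-∸-assoc 1 i≤k) (ℕₚ.+-∸-assoc 1 (ℕₚ.≤-trans i≤k k≤R)) ⟩
  - s * ℕ→ℚ (suc n C suc j) + s * ℕ→ℚ (n C j)
    ≡⟨ cong (λ c → - s * c + s * ℕ→ℚ (n C j)) (trans (sym (ℕ→ℚ-+ (n C j) (n C suc j))) (cong ℕ→ℚ (nCk+nC[k+1]≡[n+1]C[k+1] n j))) ⟨
  - s * (ℕ→ℚ (n C j) + ℕ→ℚ (n C suc j)) + s * ℕ→ℚ (n C j)
    ≡⟨ cancel s (ℕ→ℚ (n C j)) _ ⟩
  - s * ℕ→ℚ (n C suc j)
    ≡⟨ cong (λ a → sgn a * ℕ→ℚ (n C a)) (ℕₚ.+-∸-assoc 1 i≤k) ⟨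
  sgn (suc k ∸ i) * ℕ→ℚ ((R ∸ i) C (suc k ∸ i)) ∎
  where
  open ≡-Reasoning
  n = R ∸ i
  j = k ∸ i
  s = sgn j
  cancel : ∀ s a b → - s * (a + b) + s * a ≡ - s * b
  cancel = solve-∀ ℚ-ring

hWeight-diag : ∀ R k → hWeight R k k ≡ 1ℚ
hWeight-diag R k = trans (cong (λ j → sgn j * ℕ→ℚ ((R ∸ k) C j)) (ℕₚ.n∸n≡0 k)) (*-identityˡ 1ℚ)

hT-pascal : ∀ R g {k} → k ≤ R → hT (suc R) g (suc k) + hT R g k ≡ hT R g (suc k)
hT-pascal R g {k} k≤R = begin
  A + hWeight (suc R) (suc k) (suc k) * g (suc k) + hT R g k
    ≡⟨ swap A _ (hT R g k) ⟩
  A + hT R g k + hWeight (suc R) (suc k) (suc k) * g (suc k)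
    ≡⟨ cong₂ _+_ (Σ-+ (suc k) _ _) (cong (_* g (suc k)) (sym (hWeight-diag (suc R) (suc k)))) ⟨
  Σ< (suc k) (λ i → hWeight (suc R) i (suc k) * g i + hWeight R i k * g i) + 1ℚ * g (suc k)
    ≡⟨ cong₂ _+_ (Σ-cong (suc k) λ {i} i<1+k → trans (distrib (hWeight (suc R) i (suc k)) (hWeight R i k) (g i)) (cong (_* g i) (hWeight-pascal (ℕₚ.≤-pred i<1+k) k≤R)))
                 (cong (_* g (suc k)) (sym (hWeight-diag R (suc k)))) ⟩
  hT R g (suc k) ∎
  where
  open ≡-Reasoning
  A = Σ< (suc k) (λ i → hWeight (suc R) i (suc k) * g i)
  swap : ∀ a b c → a + b + c ≡ a + c + b
  swap = solve-∀ ℚ-ring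
  distrib : ∀ v w x → v * x + w * x ≡ (v + w) * x
  distrib = solve-∀ ℚ-ring

hT-join : ∀ R Q {g g′} → g′ 0 ≡ g 0 → (∀ i → g′ (suc i) ≡ g (suc i) + Q * g i) →
  ∀ {k} → k ≤ R → hT (suc R) g′ (suc k) ≡ hT R g (suc k) + (Q - 1ℚ) * hT R g k
hT-join R Q {g} {g′} g′₀ g′-suc {k} k≤R = begin
  hT (suc R) g′ (suc k)                  ≡⟨ hT-reindex R Q g′₀ g′-suc k ⟩
  hT (suc R) g (suc k) + Q * h           ≡⟨ cong (_+ Q * h) (undo (hT (suc R) g (suc k)) h) ⟩
  hT (suc R) g (suc k) + h - h + Q * h   ≡⟨ cong (λ x → x - h + Q * h) (hT-pascal R g k≤R) ⟩
  hT R g (suc k) - h + Q * h             ≡⟨ regroup (hT R g (suc k)) h Q ⟩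
  hT R g (suc k) + (Q - 1ℚ) * h          ∎
  where
  open ≡-Reasoning
  h = hT R g k
  undo : ∀ x y → x ≡ x + y - y
  undo = solve-∀ ℚ-ring
  regroup : ∀ x y q → x - y + q * y ≡ x + (q - 1ℚ) * y
  regroup = solve-∀ ℚ-ring

-- h_k(Δ^{(n)}): [m] has h-polynomial 1 + (m - 1) x, and the join with [q] multiplies it by 1 + (q - 1) x.
hΔ : ℚ → ℚ → ℕ → ℕ → ℚ
hΔ M Q zero    zero          = 1ℚ
hΔ M Q zero    (suc zero)    = M - 1ℚ
hΔ M Q zero    (suc (suc k)) = 0ℚ
hΔ M Q (suc n) zero          = 1ℚ
hΔ M Q (suc n) (suc k)       = hΔ M Q n (suc k) + (Q - 1ℚ) * hΔ M Q n k

hΔ-zero : ∀ M Q n → hΔ M Q n 0 ≡ 1ℚ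
hΔ-zero M Q zero    = refl
hΔ-zero M Q (suc n) = refl

hΔ-vanish : ∀ M Q n {k} → suc n < k → hΔ M Q n k ≡ 0ℚ
hΔ-vanish M Q zero    {suc (suc k)} _         = refl
hΔ-vanish M Q zero    {suc zero}    (s≤s ())
hΔ-vanish M Q (suc n) {suc k}       (s≤s n<k) = begin
  hΔ M Q n (suc k) + (Q - 1ℚ) * hΔ M Q n k
    ≡⟨ cong₂ (λ x y → x + (Q - 1ℚ) * y) (hΔ-vanish M Q n (ℕₚ.m<n⇒m<1+n n<k)) (hΔ-vanish M Q n n<k) ⟩
  0ℚ + (Q - 1ℚ) * 0ℚ
    ≡⟨ vanish (Q - 1ℚ) ⟩
  0ℚ ∎
  where
  open ≡-Reasoning
  vanish : ∀ x → 0ℚ + x * 0ℚ ≡ 0ℚ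
  vanish = solve-∀ ℚ-ring

hT-Δ : ∀ m q n k → hT (suc n) (ℕ→ℚ ∘ fΔ m q n) k ≡ hΔ (ℕ→ℚ m) (ℕ→ℚ q) n k
hT-Δ m q zero    zero          = hT-zero 1 (ℕ→ℚ ∘ fΔ m q 0)
hT-Δ m q zero    (suc zero)    = simplify (ℕ→ℚ m)
  where
  simplify : ∀ x → 0ℚ + - 1ℚ * 1ℚ * 1ℚ + 1ℚ * 1ℚ * x ≡ x - 1ℚ
  simplify = solve-∀ ℚ-ring
hT-Δ m q zero    (suc (suc k)) = hT-vanish 1 (ℕ→ℚ ∘ fΔ m q 0) (λ 1<i → cong ℕ→ℚ (fΔ-vanish m q 0 1<i)) {suc (suc k)} (s≤s (s≤s z≤n))
hT-Δ m q (suc n) zero          = hT-zero (suc (suc n)) (ℕ→ℚ ∘ fΔ m q (suc n))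
hT-Δ m q (suc n) (suc k) = by-size (suc k ℕ.≤? suc (suc n))
  where
  g = ℕ→ℚ ∘ fΔ m q n
  join-step : ∀ i → ℕ→ℚ (fΔ m q (suc n) (suc i)) ≡ g (suc i) + ℕ→ℚ q * g i
  join-step i = trans (ℕ→ℚ-+ (fΔ m q n (suc i)) _) (cong (g (suc i) +_) (ℕ→ℚ-* q _))
  by-size : Dec (suc k ≤ suc (suc n)) → hT (suc (suc n)) (ℕ→ℚ ∘ fΔ m q (suc n)) (suc k) ≡ hΔ (ℕ→ℚ m) (ℕ→ℚ q) (suc n) (suc k)
  by-size (yes k<2+n) = trans (hT-join (suc n) (ℕ→ℚ q) (cong ℕ→ℚ (sym (fΔ-zero m q n))) join-step (ℕₚ.≤-pred k<2+n))
                              (cong₂ (λ x y → x + (ℕ→ℚ q - 1ℚ) * y) (hT-Δ m q n (suc k)) (hT-Δ m q n k))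
  by-size (no k≮2+n)  = trans (hT-vanish (suc (suc n)) (ℕ→ℚ ∘ fΔ m q (suc n)) (λ 2+n<i → cong ℕ→ℚ (fΔ-vanish m q (suc n) 2+n<i)) (ℕₚ.≰⇒> k≮2+n))
                              (sym (hΔ-vanish (ℕ→ℚ m) (ℕ→ℚ q) (suc n) (ℕₚ.≰⇒> k≮2+n)))

Hmat-Δ : ∀ m′ q′ i k → Hmat (suc m′) (suc q′) (suc i) k ≡ hΔ (ℕ→ℚ (suc m′)) (ℕ→ℚ (suc q′)) i k
Hmat-Δ m′ q′ i k with k ≤? rank (Δ (suc m′) (suc q′) i)
... | yes k≤R = begin
  hnum K k                            ≡⟨ hnum-hT K k k≤R ⟩
  hT (rank K) (ℕ→ℚ ∘ fnum K) k        ≡⟨ cong (λ R → hT R (ℕ→ℚ ∘ fnum K) k) (rank-Δ m′ q′ i) ⟩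
  hT (suc i) (ℕ→ℚ ∘ fnum K) k         ≡⟨ hT-cong (suc i) (cong ℕ→ℚ ∘ fnum-Δ (suc m′) (suc q′) i) k ⟩
  hT (suc i) (ℕ→ℚ ∘ fΔ (suc m′) (suc q′) i) k ≡⟨ hT-Δ (suc m′) (suc q′) i k ⟩
  hΔ (ℕ→ℚ (suc m′)) (ℕ→ℚ (suc q′)) i k ∎
  where
  open ≡-Reasoning
  K = Δ (suc m′) (suc q′) i
... | no  k≰R = sym (hΔ-vanish (ℕ→ℚ (suc m′)) (ℕ→ℚ (suc q′)) i (subst (_< k) (rank-Δ m′ q′ i) (ℕₚ.≰⇒> k≰R)))

onesAfter : ℚ → PS
onesAfter μ zero    = μ
onesAfter μ (suc k) = 1ℚ

onesAfter-cong : ∀ {μ μ′} → μ ≡ μ′ → onesAfter μ ≗ onesAfter μ′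
onesAfter-cong refl k = refl

Riordan-pascal : ∀ {p L} → p * inv0 p ≡ 1ℚ → (∀ j → L 0 (suc j) ≡ 0ℚ) → (∀ j → L 0 j ≡ inv0 p * L 1 (suc j)) →
  (∀ n j → L (suc (suc n)) (suc j) ≡ L (suc n) (suc j) + p * L (suc n) j) →
  Riordan (inv0 p) (- inv0 p) L
Riordan-pascal {p} {L} p·p⁻¹ top row₀ rows = record { step = step ; top = top }
  where
  open ≡-Reasoning
  step : ∀ i j → L i j ≡ inv0 p * L (suc i) (suc j) + - inv0 p * L i (suc j)
  step zero j = begin
    L 0 j                                                 ≡⟨ row₀ j ⟩
    inv0 p * L 1 (suc j)                                  ≡⟨ pad (inv0 p) (L 1 (suc j)) ⟩
    inv0 p * L 1 (suc j) + - inv0 p * 0ℚ                  ≡⟨ cong (λ x → inv0 p * L 1 (suc j) + - inv0 p * x) (top j) ⟨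
    inv0 p * L 1 (suc j) + - inv0 p * L 0 (suc j)         ∎
    where
    pad : ∀ e x → e * x ≡ e * x + - e * 0ℚ
    pad = solve-∀ ℚ-ring
  step (suc n) j = begin
    L (suc n) j                                           ≡⟨ *-identityˡ (L (suc n) j) ⟨
    1ℚ * L (suc n) j                                      ≡⟨ cong (_* L (suc n) j) p·p⁻¹ ⟨
    p * inv0 p * L (suc n) j                              ≡⟨ expand p (inv0 p) (L (suc n) (suc j)) (L (suc n) j) ⟩
    inv0 p * (X + p * L (suc n) j) + - inv0 p * X         ≡⟨ cong (λ x → inv0 p * x + - inv0 p * X) (rows n j) ⟨
    inv0 p * L (suc (suc n)) (suc j) + - inv0 p * X       ∎
    where
    X = L (suc n) (suc j)
    expand : ∀ p e x y → p * e * y ≡ e * (x + p * y) + - e * x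
    expand = solve-∀ ℚ-ring

Ftilde-suc : ∀ m q n k → Ftilde m q (suc n) k ≡ ℕ→ℚ (fΔ m q n k)
Ftilde-suc m q n k = cong ℕ→ℚ (fnum-Δ m q n k)

Riordan-Ftilde : ∀ m q → ℕ→ℚ q * inv0 (ℕ→ℚ q) ≡ 1ℚ → Riordan (inv0 (ℕ→ℚ q)) (- inv0 (ℕ→ℚ q)) (Ftilde m q)
Riordan-Ftilde m q Q·Q⁻¹ = Riordan-pascal {ℕ→ℚ q} {Ftilde m q} Q·Q⁻¹ (λ j → refl) row₀ rows
  where
  Q = ℕ→ℚ q
  row₀ : ∀ j → Ftilde m q 0 j ≡ inv0 Q * Ftilde m q 1 (suc j)
  row₀ zero    = trans (*-comm (ℕ→ℚ m) (inv0 Q)) (cong (inv0 Q *_) (sym (Ftilde-suc m q 0 1)))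
  row₀ (suc j) = sym (trans (cong (inv0 Q *_) (Ftilde-suc m q 0 (suc (suc j)))) (*-zeroʳ (inv0 Q)))
  rows : ∀ n j → Ftilde m q (suc (suc n)) (suc j) ≡ Ftilde m q (suc n) (suc j) + Q * Ftilde m q (suc n) j
  rows n j = begin
    Ftilde m q (suc (suc n)) (suc j)                         ≡⟨ Ftilde-suc m q (suc n) (suc j) ⟩
    ℕ→ℚ (fΔ m q n (suc j) ℕ.+ q ℕ.* fΔ m q n j)              ≡⟨ ℕ→ℚ-+ (fΔ m q n (suc j)) _ ⟩
    ℕ→ℚ (fΔ m q n (suc j)) + ℕ→ℚ (q ℕ.* fΔ m q n j)          ≡⟨ cong₂ _+_ (Ftilde-suc m q n (suc j)) (sym (ℕ→ℚ-* q (fΔ m q n j))) ⟨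
    Ftilde m q (suc n) (suc j) + Q * ℕ→ℚ (fΔ m q n j)        ≡⟨ cong (λ x → Ftilde m q (suc n) (suc j) + Q * x) (Ftilde-suc m q n j) ⟨
    Ftilde m q (suc n) (suc j) + Q * Ftilde m q (suc n) j    ∎
    where open ≡-Reasoning

col₀-Ftilde : ∀ m q → col 0 (Ftilde m q) ≗ onesAfter (ℕ→ℚ m ÷₀ ℕ→ℚ q)
col₀-Ftilde m q zero    = refl
col₀-Ftilde m q (suc n) = trans (Ftilde-suc m q n 0) (cong ℕ→ℚ (fΔ-zero m q n))

Riordan-Hmat : ∀ m′ q′ → (ℕ→ℚ (suc q′) - 1ℚ) * inv0 (ℕ→ℚ (suc q′) - 1ℚ) ≡ 1ℚ →
  Riordan (inv0 (ℕ→ℚ (suc q′) - 1ℚ)) (- inv0 (ℕ→ℚ (suc q′) - 1ℚ)) (Hmat (suc m′) (suc q′))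
Riordan-Hmat m′ q′ Q-1·⁻¹ = Riordan-pascal {ℕ→ℚ (suc q′) - 1ℚ} {Hmat (suc m′) (suc q′)} Q-1·⁻¹ (λ j → refl) row₀ rows
  where
  H = Hmat (suc m′) (suc q′)
  e = inv0 (ℕ→ℚ (suc q′) - 1ℚ)
  row₀ : ∀ j → H 0 j ≡ e * H 1 (suc j)
  row₀ zero    = trans (*-comm (ℕ→ℚ (suc m′) - 1ℚ) e) (cong (e *_) (sym (Hmat-Δ m′ q′ 0 1)))
  row₀ (suc j) = sym (trans (cong (e *_) (Hmat-Δ m′ q′ 0 (suc (suc j)))) (*-zeroʳ e))
  rows : ∀ n j → H (suc (suc n)) (suc j) ≡ H (suc n) (suc j) + (ℕ→ℚ (suc q′) - 1ℚ) * H (suc n) j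
  rows n j = trans (Hmat-Δ m′ q′ (suc n) (suc j))
    (sym (cong₂ (λ x y → x + (ℕ→ℚ (suc q′) - 1ℚ) * y) (Hmat-Δ m′ q′ n (suc j)) (Hmat-Δ m′ q′ n j)))

col₀-Hmat : ∀ m′ q′ → col 0 (Hmat (suc m′) (suc q′)) ≗ onesAfter ((ℕ→ℚ (suc m′) - 1ℚ) ÷₀ (ℕ→ℚ (suc q′) - 1ℚ))
col₀-Hmat m′ q′ zero    = refl
col₀-Hmat m′ q′ (suc n) = trans (Hmat-Δ m′ q′ n 0) (hΔ-zero _ _ n)

Riordan-binomial : Riordan 1ℚ (- 1ℚ) (λ i j → ℕ→ℚ (i C j))
Riordan-binomial = record { step = step ; top = λ j → refl }
  where
  step : ∀ i j → ℕ→ℚ (i C j) ≡ 1ℚ * ℕ→ℚ (suc i C suc j) + - 1ℚ * ℕ→ℚ (i C suc j)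
  step i j = begin
    ℕ→ℚ (i C j)
      ≡⟨ cancel (ℕ→ℚ (i C j)) (ℕ→ℚ (i C suc j)) ⟩
    1ℚ * (ℕ→ℚ (i C j) + ℕ→ℚ (i C suc j)) + - 1ℚ * ℕ→ℚ (i C suc j) ≡⟨ cong (λ x → 1ℚ * x + - 1ℚ * ℕ→ℚ (i C suc j))
                                                                       (trans (sym (ℕ→ℚ-+ (i C j) _)) (cong ℕ→ℚ (nCk+nC[k+1]≡[n+1]C[k+1] i j))) ⟩
    1ℚ * ℕ→ℚ (suc i C suc j) + - 1ℚ * ℕ→ℚ (i C suc j) ∎
    where
    open ≡-Reasoning
    cancel : ∀ x y → x ≡ 1ℚ * (x + y) + - 1ℚ * y
    cancel = solve-∀ ℚ-ring

module _ {e e′ μ μ′ L L′} (RL : Riordan e (- e) L) (col₀L : col 0 L ≗ onesAfter μ)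
         (RL′ : Riordan e′ (- e′) L′) (col₀L′ : col 0 L′ ≗ onesAfter μ′) (e≢0 : e ≢ 0ℚ) where

  -- The denominator c + (1 - c) x of A makes the recurrences of L and A ⊙ L′ agree, and the
  -- last hypothesis is the condition of ▷-column for col 0 L = A ▷ col 0 L′.
  factor-left : ∀ {c A} → Riordan c (1ℚ - c) A → c * e′ ≡ e →
    lin (μ′ * c) (1ℚ - μ′ * c) (col 0 A) ≗ lin c (- c) (onesAfter μ) → L ≋ (A ⊙ L′)
  factor-left {c} {A} RA ce′≡e column = Riordan-unique RL e≢0 RA⊙L′ column₀
    where
    open ≡-Reasoning
    c≢0 = ≢0-factorˡ ce′≡e e≢0
    RA⊙L′ : Riordan e (- e) (A ⊙ L′)
    RA⊙L′ = subst₂ (λ a b → Riordan a b (A ⊙ L′))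
      (trans (*-comm e′ c) ce′≡e) (trans (simplify c e′) (cong -_ ce′≡e)) (Riordan-⊙ RA c≢0 RL′)
      where
      simplify : ∀ c e′ → e′ * (1ℚ - c) + - e′ ≡ - (c * e′)
      simplify = solve-∀ ℚ-ring
    ones-μ′ : lin 1ℚ (- 1ℚ) (col 0 L′) ≗ poly (μ′ ∷ 1ℚ - μ′ ∷ [])
    ones-μ′ n = trans (lin-cong _ _ col₀L′ n) (ones n)
      where
      ones : ∀ n → lin 1ℚ (- 1ℚ) (onesAfter μ′) n ≡ poly (μ′ ∷ 1ℚ - μ′ ∷ []) n
      ones zero          = *-identityˡ μ′
      ones (suc zero)    = trans (cong (_+ - 1ℚ * μ′) (*-identityˡ 1ℚ)) (cong (1ℚ +_) (neg μ′))
        where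
        neg : ∀ x → - 1ℚ * x ≡ - x
        neg = solve-∀ ℚ-ring
      ones (suc (suc n)) = refl
    column₀ : col 0 L ≗ col 0 (A ⊙ L′)
    column₀ = lin-cancel c≢0 λ n → begin
      lin c (- c) (col 0 L) n                                     ≡⟨ lin-cong c (- c) col₀L n ⟩
      lin c (- c) (onesAfter μ) n                                 ≡⟨ column n ⟨
      lin (μ′ * c) (1ℚ - μ′ * c) (col 0 A) n                      ≡⟨ lin-coeffs refl (regroup μ′ c) (col 0 A) n ⟩
      lin (μ′ * c) (μ′ * (1ℚ - c) + (1ℚ - μ′)) (col 0 A) n        ≡⟨ ▷-column RA c≢0 ones-μ′ n ⟨
      lin (1ℚ * c) (1ℚ * (1ℚ - c) + - 1ℚ) (A ▷ col 0 L′) n        ≡⟨ lin-coeffs (*-identityˡ c) (unit c) (A ▷ col 0 L′) n ⟩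
      lin c (- c) (A ▷ col 0 L′) n                                ∎
      where
      regroup : ∀ μ′ c → 1ℚ - μ′ * c ≡ μ′ * (1ℚ - c) + (1ℚ - μ′)
      regroup = solve-∀ ℚ-ring
      unit : ∀ c → 1ℚ * (1ℚ - c) + - 1ℚ ≡ - c
      unit = solve-∀ ℚ-ring

  factor-right : ∀ {c B d₀ d₁ n₀ n₁} → Riordan c 0ℚ B → c * e′ ≡ e →
    lin d₀ d₁ (col 0 B) ≗ poly (n₀ ∷ n₁ ∷ []) → d₀ ≢ 0ℚ →
    lin (d₀ * e′) (d₁ - d₀ * e′) (onesAfter μ) ≗ lin (n₀ * e′) (n₁ - n₀ * e′) (onesAfter μ′) →
    L ≋ (L′ ⊙ B)
  factor-right {c} {B} {d₀} {d₁} {n₀} {n₁} RB ce′≡e Dv≗N d₀≢0 column =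
    Riordan-unique RL e≢0 RL′⊙B column₀
    where
    open ≡-Reasoning
    e′≢0 = ≢0-factorʳ {c} ce′≡e e≢0
    RL′⊙B : Riordan e (- e) (L′ ⊙ B)
    RL′⊙B = subst₂ (λ a b → Riordan a b (L′ ⊙ B))
      ce′≡e (trans (simplify c e′) (cong -_ ce′≡e)) (Riordan-⊙ RL′ e′≢0 RB)
      where
      simplify : ∀ c e′ → c * - e′ + 0ℚ ≡ - (c * e′)
      simplify = solve-∀ ℚ-ring
    column₀ : col 0 L ≗ col 0 (L′ ⊙ B)
    column₀ = lin-cancel (*-≢0 d₀≢0 e′≢0) λ i → begin
      lin (d₀ * e′) (d₁ - d₀ * e′) (col 0 L) i             ≡⟨ lin-cong _ _ col₀L i ⟩
      lin (d₀ * e′) (d₁ - d₀ * e′) (onesAfter μ) i         ≡⟨ column i ⟩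
      lin (n₀ * e′) (n₁ - n₀ * e′) (onesAfter μ′) i        ≡⟨ lin-cong _ _ col₀L′ i ⟨
      lin (n₀ * e′) (n₁ - n₀ * e′) (col 0 L′) i            ≡⟨ lin-coeffs refl (swap n₀ n₁ e′) (col 0 L′) i ⟩
      lin (n₀ * e′) (n₀ * - e′ + n₁) (col 0 L′) i          ≡⟨ ▷-column RL′ e′≢0 Dv≗N i ⟨
      lin (d₀ * e′) (d₀ * - e′ + d₁) (L′ ▷ col 0 B) i      ≡⟨ lin-coeffs refl (swap d₀ d₁ e′) (L′ ▷ col 0 B) i ⟨
      lin (d₀ * e′) (d₁ - d₀ * e′) (L′ ▷ col 0 B) i        ∎
      where
      swap : ∀ d₀ d₁ e′ → d₁ - d₀ * e′ ≡ d₀ * - e′ + d₁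
      swap = solve-∀ ℚ-ring

module _ {e e′ c L L′} (RL : Riordan e (- e) L) (col₀L : col 0 L ≗ onesAfter 1ℚ)
         (RL′ : Riordan e′ (- e′) L′) (col₀L′ : col 0 L′ ≗ onesAfter 1ℚ) (e≢0 : e ≢ 0ℚ)
         (ce′≡e : c * e′ ≡ e) where

  private
    c≢0 : c ≢ 0ℚ
    c≢0 = ≢0-factorˡ ce′≡e e≢0

  factor-left-ones : ∀ {ω} → Linear ω c (1ℚ - c) → L ≋ (T (const c) ω ⊙ L′)
  factor-left-ones {ω} ω≗ = factor-left RL col₀L RL′ col₀L′ e≢0 (Riordan-T (const c) ω≗ c≢0) ce′≡e column
    where
    column : lin (1ℚ * c) (1ℚ - 1ℚ * c) (col 0 (T (const c) ω)) ≗ lin c (- c) (onesAfter 1ℚ)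
    column n = trans (lin-coeffs (*-identityˡ c) (cong (λ x → 1ℚ - x) (*-identityˡ c)) _ n)
                     (trans (lin-col₀-T (const c) ω≗ c≢0 n) (ones n))
      where
      cancel : ∀ c → 0ℚ ≡ c * 1ℚ + - c * 1ℚ
      cancel = solve-∀ ℚ-ring
      ones : ∀ n → const c n ≡ lin c (- c) (onesAfter 1ℚ) n
      ones zero          = sym (*-identityʳ c)
      ones (suc zero)    = cancel c
      ones (suc (suc n)) = cancel c

  factor-right-ones : L ≋ (L′ ⊙ T (const c) (const c))
  factor-right-ones = factor-right RL col₀L RL′ col₀L′ e≢0 (Riordan-T (const c) (const-linear c) c≢0) ce′≡e
    δ-column 1≢0 (λ _ → refl)
    where
    v = col 0 (T (const c) (const c))
    v≗δ : v ≗ const 1ℚ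
    v≗δ = lin-cancel c≢0 λ n → trans (lin-col₀-T (const c) (const-linear c) c≢0 n) (sym (trans (lin-const c _ n) (scaled n)))
      where
      scaled : ∀ n → c * const 1ℚ n ≡ const c n
      scaled zero    = *-identityʳ c
      scaled (suc n) = *-zeroʳ c
    δ-column : lin 1ℚ 0ℚ v ≗ poly (1ℚ ∷ 0ℚ ∷ [])
    δ-column n = trans (lin-identity v n) (trans (v≗δ n) (δ n))
      where
      δ : ∀ n → const 1ℚ n ≡ poly (1ℚ ∷ 0ℚ ∷ []) n
      δ zero          = refl
      δ (suc zero)    = refl
      δ (suc (suc n)) = refl

-- iq and i1 stand for 1/q and 1/(q-1): after unfolding _÷₀_, r = Q i1, s = 1 i1, u = 1 iq,
-- m/q = M iq and (m-1)/(q-1) = (M - 1) i1.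
module Inverses (Q iq i1 : ℚ) (Q·iq : Q * iq ≡ 1ℚ) (Q-1·i1 : (Q - 1ℚ) * i1 ≡ 1ℚ) where

  modulo : ∀ {x y} (F : ℚ → ℚ → ℚ) → x ≡ F (Q * iq) ((Q - 1ℚ) * i1) → F 1ℚ 1ℚ ≡ y → x ≡ y
  modulo F x≡ ≡y = trans x≡ (trans (cong₂ F Q·iq Q-1·i1) ≡y)

  r·iq : Q * i1 * iq ≡ i1
  r·iq = modulo (λ w z → w * i1) (solve (Q ∷ iq ∷ i1 ∷ []) ℚ-ring) (solve (i1 ∷ []) ℚ-ring)

  -s≡1-r : - (1ℚ * i1) ≡ 1ℚ - Q * i1
  -s≡1-r = sym (modulo (λ w z → 1ℚ - z - i1) (solve (Q ∷ i1 ∷ []) ℚ-ring) (solve (i1 ∷ []) ℚ-ring))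

  [q-1]/q≡1-u : (Q - 1ℚ) * iq ≡ 1ℚ - 1ℚ * iq
  [q-1]/q≡1-u = sym (modulo (λ w z → (Q - 1ℚ) * iq + 1ℚ - w) (solve (Q ∷ iq ∷ []) ℚ-ring) (solve (Q ∷ iq ∷ []) ℚ-ring))

  u·1 : 1ℚ * iq * 1ℚ ≡ iq
  u·1 = solve (iq ∷ []) ℚ-ring

  module _ (M : ℚ) where

    μ′r : M * iq * (Q * i1) ≡ i1 * M
    μ′r = modulo (λ w z → w * (i1 * M)) (solve (M ∷ Q ∷ iq ∷ i1 ∷ []) ℚ-ring) (solve (M ∷ i1 ∷ []) ℚ-ring)

    1-μ′r : 1ℚ - M * iq * (Q * i1) ≡ i1 * (Q - 1ℚ - M)
    1-μ′r = trans (cong (λ x → 1ℚ - x) μ′r)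
                  (sym (modulo (λ w z → z - i1 * M) (solve (M ∷ Q ∷ i1 ∷ []) ℚ-ring) (solve (M ∷ i1 ∷ []) ℚ-ring)))

    left-column₀ : i1 * (Q * i1 * (M - 1ℚ)) ≡ Q * i1 * ((M - 1ℚ) * i1)
    left-column₀ = solve (M ∷ Q ∷ i1 ∷ []) ℚ-ring

    left-column₁ : i1 * (Q * i1 * (Q - M)) ≡ Q * i1 * 1ℚ + - (Q * i1) * ((M - 1ℚ) * i1)
    left-column₁ = modulo (λ w z → Q * i1 * (z - (M - 1ℚ) * i1)) (solve (M ∷ Q ∷ i1 ∷ []) ℚ-ring) (solve (M ∷ Q ∷ i1 ∷ []) ℚ-ring)

    left-column₂ : i1 * (Q * i1 * 0ℚ) ≡ Q * i1 * 1ℚ + - (Q * i1) * 1ℚ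
    left-column₂ = solve (Q ∷ i1 ∷ []) ℚ-ring

    right-column₀ : (Q - 1ℚ) * M * iq * ((M - 1ℚ) * i1) ≡ Q * (M - 1ℚ) * iq * (M * iq)
    right-column₀ = begin
      (Q - 1ℚ) * M * iq * ((M - 1ℚ) * i1)
        ≡⟨ modulo (λ w z → M * (M - 1ℚ) * iq * z) (solve (M ∷ Q ∷ iq ∷ i1 ∷ []) ℚ-ring) (solve (M ∷ iq ∷ []) ℚ-ring) ⟩
      M * (M - 1ℚ) * iq
        ≡⟨ modulo (λ w z → M * (M - 1ℚ) * iq * w) (solve (M ∷ Q ∷ iq ∷ []) ℚ-ring) (solve (M ∷ iq ∷ []) ℚ-ring) ⟨
      Q * (M - 1ℚ) * iq * (M * iq) ∎
      where open ≡-Reasoning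

    right-column₁ : (Q - 1ℚ) * M * iq * 1ℚ + ((Q - 1ℚ) - (Q - 1ℚ) * M * iq) * ((M - 1ℚ) * i1)
                  ≡ Q * (M - 1ℚ) * iq * 1ℚ + ((Q - 1ℚ) - Q * (M - 1ℚ) * iq) * (M * iq)
    right-column₁ = begin
      (Q - 1ℚ) * M * iq * 1ℚ + ((Q - 1ℚ) - (Q - 1ℚ) * M * iq) * ((M - 1ℚ) * i1)
        ≡⟨ modulo (λ w z → (Q - 1ℚ) * M * iq + (M - 1ℚ) * z - M * iq * (M - 1ℚ) * z)
                  (solve (M ∷ Q ∷ iq ∷ i1 ∷ []) ℚ-ring) (solve (M ∷ Q ∷ iq ∷ []) ℚ-ring) ⟩
      M - 1ℚ + M * iq * (Q - M)
        ≡⟨ modulo (λ w z → (M - 1ℚ) * w + (Q - 1ℚ) * M * iq - (M - 1ℚ) * M * iq * w)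
                  (solve (M ∷ Q ∷ iq ∷ []) ℚ-ring) (solve (M ∷ Q ∷ iq ∷ []) ℚ-ring) ⟨
      Q * (M - 1ℚ) * iq * 1ℚ + ((Q - 1ℚ) - Q * (M - 1ℚ) * iq) * (M * iq) ∎
      where open ≡-Reasoning

    right-column₂ : (Q - 1ℚ) * M * iq * 1ℚ + ((Q - 1ℚ) - (Q - 1ℚ) * M * iq) * 1ℚ
                  ≡ Q * (M - 1ℚ) * iq * 1ℚ + ((Q - 1ℚ) - Q * (M - 1ℚ) * iq) * 1ℚ
    right-column₂ = solve (M ∷ Q ∷ iq ∷ []) ℚ-ring

Riordan-Ftilde-11 : Riordan 1ℚ (- 1ℚ) (Ftilde 1 1)
Riordan-Ftilde-11 = Riordan-Ftilde 1 1 refl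

col₀-Ftilde-11 : col 0 (Ftilde 1 1) ≗ onesAfter 1ℚ
col₀-Ftilde-11 = col₀-Ftilde 1 1

Ftilde-11≋T : Ftilde 1 1 ≋ T (const 1ℚ) (poly (1ℚ ∷ - 1ℚ ∷ []))
Ftilde-11≋T = Riordan-unique Riordan-Ftilde-11 1≢0 (Riordan-T (const 1ℚ) (λ _ → refl) 1≢0) column
  where
  ones : ∀ n → lin 1ℚ (- 1ℚ) (onesAfter 1ℚ) n ≡ const 1ℚ n
  ones zero          = refl
  ones (suc zero)    = refl
  ones (suc (suc n)) = refl
  column : col 0 (Ftilde 1 1) ≗ col 0 (T (const 1ℚ) (poly (1ℚ ∷ - 1ℚ ∷ [])))
  column = lin-cancel 1≢0 λ n → trans (lin-cong _ _ col₀-Ftilde-11 n)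
    (trans (ones n) (sym (lin-col₀-T (const 1ℚ) (λ _ → refl) 1≢0 n)))

Ftilde-11≡binomial : ∀ i j → Ftilde 1 1 i j ≡ ℕ→ℚ (i C j)
Ftilde-11≡binomial = Riordan-unique Riordan-Ftilde-11 1≢0 Riordan-binomial (λ i → trans (col₀-Ftilde-11 i) (ones i))
  where
  ones : ∀ i → onesAfter 1ℚ i ≡ ℕ→ℚ (i C 0)
  ones zero    = refl
  ones (suc i) = refl

module _ (q′ : ℕ) where
  private
    q = suc (suc q′)
    Q = ℕ→ℚ q
    r = Q ÷₀ (Q - 1ℚ)
    s = 1ℚ ÷₀ (Q - 1ℚ)
    u = 1ℚ ÷₀ Q
    ω₁ = poly (r ∷ (- s) ∷ [])

    Q≢0 : Q ≢ 0ℚ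
    Q≢0 = ℕ→ℚ-suc≢0 (suc q′)

    Q-1≢0 : Q - 1ℚ ≢ 0ℚ
    Q-1≢0 = ℕ→ℚ-suc≢0 q′ ∘ trans (sym Q-1≡)
      where
      predecessor : ∀ x → 1ℚ + x - 1ℚ ≡ x
      predecessor = solve-∀ ℚ-ring
      Q-1≡ : Q - 1ℚ ≡ ℕ→ℚ (suc q′)
      Q-1≡ = trans (cong (_- 1ℚ) (ℕ→ℚ-+ 1 (suc q′))) (predecessor _)

    Q·iq : Q * inv0 Q ≡ 1ℚ
    Q·iq = *-inv0 Q Q≢0
    Q-1·i1 : (Q - 1ℚ) * inv0 (Q - 1ℚ) ≡ 1ℚ
    Q-1·i1 = *-inv0 (Q - 1ℚ) Q-1≢0

    iq≢0 : inv0 Q ≢ 0ℚ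
    iq≢0 = ≢0-factorʳ {Q} Q·iq 1≢0
    i1≢0 : inv0 (Q - 1ℚ) ≢ 0ℚ
    i1≢0 = ≢0-factorʳ {Q - 1ℚ} Q-1·i1 1≢0

    open Inverses Q (inv0 Q) (inv0 (Q - 1ℚ)) Q·iq Q-1·i1

    r≢0 : r ≢ 0ℚ
    r≢0 = *-≢0 Q≢0 i1≢0

    ω₁-linear : Linear ω₁ r (1ℚ - r)
    ω₁-linear zero          = refl
    ω₁-linear (suc zero)    = -s≡1-r
    ω₁-linear (suc (suc n)) = refl

    RF : ∀ m → Riordan (inv0 Q) (- inv0 Q) (Ftilde m q)
    RF m = Riordan-Ftilde m q Q·iq

    RH : ∀ m′ → Riordan (inv0 (Q - 1ℚ)) (- inv0 (Q - 1ℚ)) (Hmat (suc m′) q)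
    RH m′ = Riordan-Hmat m′ (suc q′) Q-1·i1

    col₀-Ftilde-qq : col 0 (Ftilde q q) ≗ onesAfter 1ℚ
    col₀-Ftilde-qq n = trans (col₀-Ftilde q q n) (onesAfter-cong Q·iq n)

    col₀-Hmat-qq : col 0 (Hmat q q) ≗ onesAfter 1ℚ
    col₀-Hmat-qq n = trans (col₀-Hmat (suc q′) (suc q′) n) (onesAfter-cong Q-1·i1 n)

  Hmat-qq≋T⊙Ftilde-qq : Hmat q q ≋ (T (const r) ω₁ ⊙ Ftilde q q)
  Hmat-qq≋T⊙Ftilde-qq = factor-left-ones (RH (suc q′)) col₀-Hmat-qq (RF q) col₀-Ftilde-qq i1≢0 r·iq ω₁-linear

  Hmat-qq≋Ftilde-qq⊙T : Hmat q q ≋ (Ftilde q q ⊙ T (const r) (const r))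
  Hmat-qq≋Ftilde-qq⊙T = factor-right-ones (RH (suc q′)) col₀-Hmat-qq (RF q) col₀-Ftilde-qq i1≢0 r·iq

  Ftilde-qq≋T⊙Ftilde-11 : Ftilde q q ≋ (T (const u) (poly (u ∷ ((Q - 1ℚ) ÷₀ Q) ∷ [])) ⊙ Ftilde 1 1)
  Ftilde-qq≋T⊙Ftilde-11 = factor-left-ones (RF q) col₀-Ftilde-qq Riordan-Ftilde-11 col₀-Ftilde-11 iq≢0 u·1 ω-linear
    where
    ω-linear : Linear (poly (u ∷ ((Q - 1ℚ) ÷₀ Q) ∷ [])) u (1ℚ - u)
    ω-linear zero          = refl
    ω-linear (suc zero)    = [q-1]/q≡1-u
    ω-linear (suc (suc n)) = refl

  Ftilde-qq≋Ftilde-11⊙T : Ftilde q q ≋ (Ftilde 1 1 ⊙ T (const u) (const u))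
  Ftilde-qq≋Ftilde-11⊙T = factor-right-ones (RF q) col₀-Ftilde-qq Riordan-Ftilde-11 col₀-Ftilde-11 iq≢0 u·1

  module _ (m′ : ℕ) where
    private
      m = suc m′
      M = ℕ→ℚ m
      N₁ = poly ((M - 1ℚ) ∷ (Q - M) ∷ [])
      D₁ = poly (M ∷ (Q - 1ℚ - M) ∷ [])
      Y₁ = (N₁ ·ₛ invₛ D₁) ·ₛ const r
      N₂ = poly ((Q * (M - 1ℚ)) ∷ (Q - 1ℚ) ∷ [])
      D₂ = poly (((Q - 1ℚ) * M) ∷ (Q - 1ℚ) ∷ [])
      Y₂ = N₂ ·ₛ invₛ D₂

      M≢0 : M ≢ 0ℚ
      M≢0 = ℕ→ℚ-suc≢0 m′

      D₁Y₁≗ : lin M (Q - 1ℚ - M) Y₁ ≗ λ n → r * N₁ n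
      D₁Y₁≗ n = begin
        lin M (Q - 1ℚ - M) ((N₁ ·ₛ invₛ D₁) ·ₛ const r) n   ≡⟨ lin-·ₛ M _ (N₁ ·ₛ invₛ D₁) (const r) n ⟨
        (lin M (Q - 1ℚ - M) (N₁ ·ₛ invₛ D₁) ·ₛ const r) n   ≡⟨ ·ₛ-congˡ (lin-·ₛ-invₛ (Q - 1ℚ - M) N₁ M≢0) (const r) n ⟩
        (N₁ ·ₛ const r) n                                    ≡⟨ ·ₛ-const r N₁ n ⟩
        r * N₁ n                                             ∎
        where open ≡-Reasoning

      column₁ : lin ((M ÷₀ Q) * r) (1ℚ - (M ÷₀ Q) * r) (col 0 (T (Y₁ ·ₛ ω₁) ω₁)) ≗ lin r (- r) (onesAfter ((M - 1ℚ) ÷₀ (Q - 1ℚ)))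
      column₁ n = begin
        lin ((M ÷₀ Q) * r) (1ℚ - (M ÷₀ Q) * r) A₀ n
          ≡⟨ lin-coeffs (μ′r M) (1-μ′r M) A₀ n ⟩
        lin (inv0 (Q - 1ℚ) * M) (inv0 (Q - 1ℚ) * (Q - 1ℚ - M)) A₀ n
          ≡⟨ lin-scale (inv0 (Q - 1ℚ)) M (Q - 1ℚ - M) A₀ n ⟩
        inv0 (Q - 1ℚ) * lin M (Q - 1ℚ - M) A₀ n
          ≡⟨ cong (inv0 (Q - 1ℚ) *_) (trans (lin-cong M _ (col₀-T-·ₛ Y₁ ω₁-linear r≢0) n) (D₁Y₁≗ n)) ⟩
        inv0 (Q - 1ℚ) * (r * N₁ n)
          ≡⟨ values n ⟩
        lin r (- r) (onesAfter ((M - 1ℚ) ÷₀ (Q - 1ℚ))) n ∎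
        where
        open ≡-Reasoning
        A₀ = col 0 (T (Y₁ ·ₛ ω₁) ω₁)
        values : ∀ n → inv0 (Q - 1ℚ) * (r * N₁ n) ≡ lin r (- r) (onesAfter ((M - 1ℚ) ÷₀ (Q - 1ℚ))) n
        values zero          = left-column₀ M
        values (suc zero)    = left-column₁ M
        values (suc (suc n)) = left-column₂ M

      D₂v≗N₂ : lin ((Q - 1ℚ) * M) (Q - 1ℚ) (col 0 (T (Y₂ ·ₛ const r) (const r))) ≗ N₂
      D₂v≗N₂ n = trans (lin-cong _ _ (col₀-T-·ₛ Y₂ (const-linear r) r≢0) n) (lin-·ₛ-invₛ (Q - 1ℚ) N₂ (*-≢0 Q-1≢0 M≢0) n)

      column₂ : lin ((Q - 1ℚ) * M * inv0 Q) ((Q - 1ℚ) - (Q - 1ℚ) * M * inv0 Q) (onesAfter ((M - 1ℚ) ÷₀ (Q - 1ℚ)))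
              ≗ lin (Q * (M - 1ℚ) * inv0 Q) ((Q - 1ℚ) - Q * (M - 1ℚ) * inv0 Q) (onesAfter (M ÷₀ Q))
      column₂ zero          = right-column₀ M
      column₂ (suc zero)    = right-column₁ M
      column₂ (suc (suc n)) = right-column₂ M

    Hmat≋T⊙Ftilde : Hmat m q ≋ (T (Y₁ ·ₛ ω₁) ω₁ ⊙ Ftilde m q)
    Hmat≋T⊙Ftilde = factor-left (RH m′) (col₀-Hmat m′ (suc q′)) (RF m) (col₀-Ftilde m q) i1≢0
      (Riordan-T (Y₁ ·ₛ ω₁) ω₁-linear r≢0) r·iq column₁

    Hmat≋Ftilde⊙T : Hmat m q ≋ (Ftilde m q ⊙ T (Y₂ ·ₛ const r) (const r))
    Hmat≋Ftilde⊙T = factor-right (RH m′) (col₀-Hmat m′ (suc q′)) (RF m) (col₀-Ftilde m q) i1≢0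
      (Riordan-T (Y₂ ·ₛ const r) (const-linear r) r≢0) r·iq D₂v≗N₂ (*-≢0 Q-1≢0 M≢0) column₂

proposition5p7 : (m q : ℕ) → 2 ≤ m → 2 ≤ q →
    let M = ℕ→ℚ m
        Q = ℕ→ℚ q
        r = Q ÷₀ (Q - 1ℚ)
        s = 1ℚ ÷₀ (Q - 1ℚ)
        -- (q - x)/(q - 1)
        ω₁ = poly (r ∷ (- s) ∷ [])
        -- (m-1+(q-m)x)/(m+(q-1-m)x) · q/(q-1) · (q-x)/(q-1)
        α₁ = ((poly ((M - 1ℚ) ∷ (Q - M) ∷ []) ·ₛ invₛ (poly (M ∷ (Q - 1ℚ - M) ∷ [])))
               ·ₛ const r) ·ₛ ω₁
        -- (q(m-1)+(q-1)x)/((q-1)(m+x)) · q/(q-1)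
        α₂ = (poly ((Q * (M - 1ℚ)) ∷ (Q - 1ℚ) ∷ [])
               ·ₛ invₛ (poly (((Q - 1ℚ) * M) ∷ (Q - 1ℚ) ∷ []))) ·ₛ const r
        ω₂ = const r
        F₁₁ = Ftilde 1 1
        u = 1ℚ ÷₀ Q
    in (Hmat m q ≋ (T α₁ ω₁ ⊙ Ftilde m q))
     × (Hmat m q ≋ (Ftilde m q ⊙ T α₂ ω₂))
     × (Hmat q q ≋ (T (const r) ω₁ ⊙ Ftilde q q))
     × (Hmat q q ≋ (Ftilde q q ⊙ T (const r) (const r)))
     × (F₁₁ ≋ T (const 1ℚ) (poly (1ℚ ∷ (- 1ℚ) ∷ [])))
     × (∀ i j → F₁₁ i j ≡ ℕ→ℚ (i C j))
     × (Ftilde q q ≋ (T (const u) (poly (u ∷ ((Q - 1ℚ) ÷₀ Q) ∷ [])) ⊙ F₁₁))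
     × (Ftilde q q ≋ (F₁₁ ⊙ T (const u) (const u)))
proposition5p7 (suc m′) (suc (suc q′)) _ (s≤s (s≤s _)) =
    Hmat≋T⊙Ftilde q′ m′ , Hmat≋Ftilde⊙T q′ m′ , Hmat-qq≋T⊙Ftilde-qq q′ , Hmat-qq≋Ftilde-qq⊙T q′
  , Ftilde-11≋T , Ftilde-11≡binomial , Ftilde-qq≋T⊙Ftilde-11 q′ , Ftilde-qq≋Ftilde-11⊙T q′
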